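{- Let $n\ge 2$, $m\ge 1$, let $R$ be a dominant region of the $m$-Shi arrangement with $m$-minimal alcove $\mathcal A$, and let $\lambda$ be the $n$-core with $\Psi(\lambda)=\mathcal A$. Then $H_{\theta,m}$ is a separating wall for $R$ if and only if $h^\lambda_{11}=n(m-1)+1$, where $h^\lambda_{11}$ is the hook length of the box $(1,1)$ of $\lambda$.
   Context: Let $e_1,\dots,e_n$ be the standard basis of $\mathbb R^n$ with the standard inner product $\langle\cdot,\cdot\rangle$, and $V=\{(a_1,\dots,a_n)\in\mathbb R^n:\sum_i a_i=0\}$. For $1\le i\le j\le n-1$ let $\alpha_{ij}=e_i-e_{j+1}$, $\alpha_i=\alpha_{ii}$, $\Delta^+=\{\alpha_{ij}\}$, and $\theta=\alpha_{1,n-1}$. For $\alpha\in\Delta^+$, $k\in\mathbb Z$, let $H_{\alpha,k}=\{v\in V:\langle v,\alpha\rangle=k\}$. The $m$-Shi arrangement is $\{H_{\alpha,k}:\alpha\in\Delta^+,\,-m<k\le m\}$; its regions are the connected components of the complement in $V$ of the union of its hyperplanes, and a region is dominant if it lies in the dominant chamber $\{v\in V:\langle v,\alpha_i\rangle\ge0\ \forall i\}$. Alcoves are the connected components of $V\setminus\bigcup_{\alpha\in\Delta^+,k\in\mathbb Z}H_{\alpha,k}$; the fundamental alcove $A_0$ is the interior of $\{v\in V:\langle v,\theta\rangle\le1,\ \langle v,\alpha_i\rangle\ge0\ \forall i\}$. Each region contains a unique alcove separated from $A_0$ by the fewest hyperplanes $H_{\alpha,k}$ ($\alpha\in\Delta^+,k\in\mathbb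 Z$), its $m$-minimal alcove. A wall of a region $R$ is a hyperplane of the $m$-Shi arrangement supporting a facet of $R$; it is a separating wall if $R$ and $A_0$ lie in different closed half-spaces determined by it. For an alcove $\mathcal A$, its Shi coordinates are the integers $k_{ij}$ ($1\le i\le j\le n-1$) with $k_{ij}<\langle x,\alpha_{ij}\rangle<k_{ij}+1$ for all $x\in\mathcal A$; an alcove is determined by them. An $n$-core is a partition with no hook length divisible by $n$. For an $n$-core $\lambda$ with $\ell(\lambda)$ positive parts, let $B=\{h^\lambda_{k1}:1\le k\le\ell(\lambda)\}\cup\mathbb Z_{<0}$ and for $0\le i\le n-1$ let the level number $b_i$ be the least integer $q$ with $qn+i\notin B$. Put $\tilde p_i=b_{i-1}n+i-1$ ($1\le i\le n$), let $p_1<\dots<p_n$ be these in increasing order, and let $\Psi(\lambda)$ be the alcove with Shi coordinates $k_{ij}=\lfloor(p_{j+1}-p_i)/n\rfloor$. The map $\Psi$ is a bijection from $n$-cores onto dominant alcoves.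
   Formalization: Points of $V$ are taken in ℚ^n instead of $\mathbb R^n$, so regions, alcoves, their closures, walls and the separating half-spaces are all sets of such points. -}

module Defs where

open import Data.Nat as ℕ using (ℕ; zero; suc; _∸_)
open import Data.Integer as ℤ using (ℤ; +_; ∣_∣)
open import Data.Rational as ℚ using (ℚ; 0ℚ; 1ℚ)
open import Data.Fin as Fin using (Fin; toℕ)
open import Data.List using (List; []; _∷_; length)
open import Data.List.Relation.Unary.All using (All)
open import Data.List.Relation.Unary.Linked using (Linked)
open import Data.Product using (Σ; ∃; _×_; _,_)
open import Data.Sum using (_⊎_)
open import Data.Bool using (if_then_else_)
open import Relation.Nullary using (¬_)
open import Relation.Nullary.Decidable using (⌊_⌋)
open import Relation.Binary.PropositionalEquality using (_≡_; _≢_)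
open import Function.Bundles using (_⇔_)
open import Data.Nat.Divisibility using (_∣_)

sumℕ : ∀ {n} → (Fin n → ℕ) → ℕ
sumℕ {zero}  f = 0
sumℕ {suc n} f = f Fin.zero ℕ.+ sumℕ (λ i → f (Fin.suc i))

sumℚ : ∀ {n} → (Fin n → ℚ) → ℚ
sumℚ {zero}  f = 0ℚ
sumℚ {suc n} f = f Fin.zero ℚ.+ sumℚ (λ i → f (Fin.suc i))

-- Points of Q^n (rational points stand in for R^n),
-- the subspace V, and pairings with positive roots.
-- The positive root alpha = e_a - e_b is encoded by a pair a < b of
-- 0-based indices in Fin n  (alpha_{ij} = e_i - e_{j+1} <-> a = i-1, b = j).

Pt : ℕ → Set
Pt n = Fin n → ℚ

InV : ∀ {n} → Pt n → Set
InV x = sumℚ x ≡ 0ℚ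

pair : ∀ {n} → Pt n → Fin n → Fin n → ℚ
pair x a b = x a ℚ.- x b

ι : ℤ → ℚ
ι k = k ℚ./ 1

ShiLevel : ℕ → ℤ → Set
ShiLevel m k = (ℤ.- (+ m)) ℤ.< k × k ℤ.≤ + m

OnH : ∀ {n} → Pt n → Fin n → Fin n → ℤ → Set
OnH x a b k = pair x a b ≡ ι k

InComplement : ∀ {n} → ℕ → Pt n → Set
InComplement {n} m x =
  ∀ (a b : Fin n) (k : ℤ) → a Fin.< b → ShiLevel m k → ¬ OnH x a b k

InRegion : ∀ {n} → ℕ → Pt n → Pt n → Set
InRegion {n} m x0 y =
  InV y × InComplement m y ×
  (∀ (a b : Fin n) (k : ℤ) → a Fin.< b → ShiLevel m k →
     (pair x0 a b ℚ.< ι k) ⇔ (pair y a b ℚ.< ι k))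

DominantRegion : ∀ {n} → ℕ → Pt n → Set
DominantRegion {n} m x0 =
  ∀ (y : Pt n) → InRegion m x0 y →
  ∀ (a b : Fin n) → toℕ b ≡ suc (toℕ a) → 0ℚ ℚ.≤ pair y a b

InA0 : ∀ {n} → Pt n → Set
InA0 {n} x =
  InV x ×
  (∀ (a b : Fin n) → toℕ b ≡ suc (toℕ a) → 0ℚ ℚ.< pair x a b) ×
  (∀ (a b : Fin n) → toℕ a ≡ 0 → suc (toℕ b) ≡ n → pair x a b ℚ.< 1ℚ)

IsTheta : ∀ {n} → Fin n → Fin n → Set
IsTheta {n} a b = toℕ a ≡ 0 × suc (toℕ b) ≡ n

InClosure : ∀ {n} → ℕ → Pt n → Pt n → Set
InClosure {n} m x0 x =
  Σ (Pt n) λ y → InRegion m x0 y ×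
    (∀ (t : ℚ) → 0ℚ ℚ.< t → t ℚ.≤ 1ℚ →
       InRegion m x0 (λ i → x i ℚ.+ t ℚ.* (y i ℚ.- x i)))

-- H_{e_a - e_b, k} (a hyperplane of the m-Shi arrangement) is a wall of
-- R(x0): it supports a facet of R(x0), i.e. the closure of R(x0) meets
-- H in a point lying on no other hyperplane of the arrangement.
IsWall : ∀ {n} → ℕ → Pt n → Fin n → Fin n → ℤ → Set
IsWall {n} m x0 a b k =
  a Fin.< b × ShiLevel m k ×
  Σ (Pt n) λ x → InV x × OnH x a b k × InClosure m x0 x ×
    (∀ (a' b' : Fin n) (k' : ℤ) → a' Fin.< b' → ShiLevel m k' →
       ¬ (a' ≡ a × b' ≡ b × k' ≡ k) → ¬ OnH x a' b' k')

IsSeparatingWall : ∀ {n} → ℕ → Pt n → Fin n → Fin n → ℤ → Set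
IsSeparatingWall {n} m x0 a b k =
  IsWall m x0 a b k ×
  ( ( (∀ y → InRegion m x0 y → ι k ℚ.≤ pair y a b) ×
      (∀ z → InA0 z → pair z a b ℚ.≤ ι k) )
  ⊎ ( (∀ y → InRegion m x0 y → pair y a b ℚ.≤ ι k) ×
      (∀ z → InA0 z → ι k ℚ.≤ pair z a b) ) )

-- Alcoves, described by their Shi coordinates K a b (for a < b;
-- other entries are irrelevant).

Shi : ℕ → Set
Shi n = Fin n → Fin n → ℤ

InAlcove : ∀ {n} → Shi n → Pt n → Set
InAlcove {n} K x =
  InV x ×
  (∀ (a b : Fin n) → a Fin.< b →
     ι (K a b) ℚ.< pair x a b × pair x a b ℚ.< ι (K a b ℤ.+ + 1))

IsAlcove : ∀ {n} → Shi n → Set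
IsAlcove {n} K = Σ (Pt n) λ x → InAlcove K x

AlcoveInRegion : ∀ {n} → ℕ → Pt n → Shi n → Set
AlcoveInRegion {n} m x0 K = ∀ (x : Pt n) → InAlcove K x → InRegion m x0 x

-- Number of hyperplanes H_{alpha,k} (k in Z) separating the alcove with
-- Shi coordinates K from A0: for each alpha it is |K_alpha|.
sepCount : ∀ {n} → Shi n → ℕ
sepCount K = sumℕ (λ a → sumℕ (λ b → if ⌊ a Fin.<? b ⌋ then ∣ K a b ∣ else 0))

IsMinimalAlcove : ∀ {n} → ℕ → Pt n → Shi n → Set
IsMinimalAlcove {n} m x0 K =
  IsAlcove K × AlcoveInRegion m x0 K ×
  (∀ (K' : Shi n) → IsAlcove K' → AlcoveInRegion m x0 K' →
     sepCount K ℕ.≤ sepCount K')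

IsPartition : List ℕ → Set
IsPartition λ′ = All (0 ℕ.<_) λ′ × Linked ℕ._≥_ λ′

row : List ℕ → ℕ → ℕ
row []       i       = 0
row (r ∷ rs) zero    = r
row (r ∷ rs) (suc i) = row rs i

col : List ℕ → ℕ → ℕ
col []       j = 0
col (r ∷ rs) j = (if ⌊ j ℕ.<? r ⌋ then 1 else 0) ℕ.+ col rs j

-- hook length of the box (i , j) (0-based; the paper's box (i+1 , j+1))
hook : List ℕ → ℕ → ℕ → ℕ
hook λ′ i j = (row λ′ i ∸ suc j) ℕ.+ (col λ′ j ∸ suc i) ℕ.+ 1

IsCore : ℕ → List ℕ → Set
IsCore n λ′ = ∀ (i j : ℕ) → j ℕ.< row λ′ i → ¬ (n ∣ hook λ′ i j)

Hook11Is : List ℕ → ℕ → Set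
Hook11Is λ′ h = 0 ℕ.< row λ′ 0 × hook λ′ 0 0 ≡ h

InB : List ℕ → ℤ → Set
InB λ′ z = z ℤ.< + 0 ⊎ Σ ℕ λ k → k ℕ.< length λ′ × z ≡ + hook λ′ k 0

IsLevel : ℕ → List ℕ → ℕ → ℤ → Set
IsLevel n λ′ i q =
  ¬ InB λ′ (q ℤ.* + n ℤ.+ + i) ×
  (∀ (q' : ℤ) → q' ℤ.< q → InB λ′ (q' ℤ.* + n ℤ.+ + i))

-- Psi(lambda) is the alcove with Shi coordinates K
-- (the floor k = ⌊(p_b - p_a)/n⌋ is expressed as k n <= p_b - p_a < (k+1) n)
PsiIs : (n : ℕ) → List ℕ → Shi n → Set
PsiIs n λ′ K =
  Σ (Fin n → ℤ) λ lev → Σ (Fin n → ℤ) λ p →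
    (∀ (i : Fin n) → IsLevel n λ′ (toℕ i) (lev i)) ×
    -- p is the increasing rearrangement of  p~_{i+1} = b_i n + i
    (∀ (a b : Fin n) → a Fin.< b → p a ℤ.< p b) ×
    (∀ (i : Fin n) → Σ (Fin n) λ j → p j ≡ lev i ℤ.* + n ℤ.+ + toℕ i) ×
    (∀ (j : Fin n) → Σ (Fin n) λ i → p j ≡ lev i ℤ.* + n ℤ.+ + toℕ i) ×
    (∀ (a b : Fin n) → a Fin.< b →
       K a b ℤ.* + n ℤ.≤ p b ℤ.- p a ×
       p b ℤ.- p a ℤ.< (K a b ℤ.+ + 1) ℤ.* + n)

{-# OPTIONS --safe #-}
module Submission where

-- Ψ(λ) has Shi coordinates k_{ab} = ⌊(p_b − p_a)/n⌋, where p_1 < … < p_n are the positions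
-- b_i n + i, one in each residue class. The first-column hook lengths of an n-core are closed
-- under subtracting n, so p_1 = 0 and p_n = h_{11} + n; thus h_{11} = n(m−1)+1 means p_n = nm + 1.
-- If p_n = nm + 1, lowering p_n by one gives a point on H_{θ,m} in the closure of Ψ(λ) and on no
-- other hyperplane, so H_{θ,m} is a wall; it separates R (where ⟨x,θ⟩ > m) from A_0 (where
-- ⟨x,θ⟩ < 1). Conversely, a point of the wall shows k_θ ≥ m and k_{1c} + k_{c+1,n−1} < m for
-- every intermediate c, whence k_θ = m (for n = 2 by minimality instead); the position of
-- residue 1 then forces p_n ≡ 1 (mod n), so p_n = nm + 1.

open import Defs
open import Data.Nat as ℕ using (ℕ; zero; suc)
import Data.Nat.Properties as ℕP
open import Data.Integer as ℤ using (ℤ; +_; -[1+_])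
import Data.Integer.Properties as ℤP
open import Data.Rational as ℚ using (ℚ; 0ℚ; 1ℚ; toℚᵘ)
import Data.Rational.Properties as ℚP
open import Data.Rational.Unnormalised as ℚᵘ using (mkℚᵘ; *≡*; *<*; *≤*)
import Data.Rational.Unnormalised.Properties as ℚᵘP
open import Data.Fin as Fin using (Fin; toℕ)
import Data.Fin.Properties as FinP
open import Data.List using (List; []; _∷_; length)
open import Data.List.Relation.Unary.All as All using (All; []; _∷_)
open import Data.List.Relation.Unary.Linked as Linked using (Linked)
open import Data.Product using (Σ; ∃; _×_; _,_; proj₁; proj₂; map)
open import Data.Sum using (_⊎_; inj₁; inj₂)
open import Data.Empty using (⊥-elim)
open import Relation.Nullary using (¬_; yes; no)
open import Relation.Nullary.Decidable using (toSum)
open import Relation.Binary.PropositionalEquality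
open import Function.Bundles using (_⇔_; mk⇔; Equivalence)
open import Function.Construct.Composition using (equivalence)
open import Function.Construct.Symmetry using (⇔-sym)

module IntegerOrder where

  i<j⇒i+1≤j : ∀ {i j} → i ℤ.< j → i ℤ.+ + 1 ℤ.≤ j
  i<j⇒i+1≤j {i} i<j = subst (ℤ._≤ _) (ℤP.+-comm (+ 1) i) (ℤP.i<j⇒suc[i]≤j i<j)

  i<j+1⇒i≤j : ∀ {i j} → i ℤ.< j ℤ.+ + 1 → i ℤ.≤ j
  i<j+1⇒i≤j {i} {j} i<j+1 = subst (i ℤ.≤_) (ℤP.pred-suc j)
    (ℤP.i<j⇒i≤pred[j] (subst (i ℤ.<_) (ℤP.+-comm j (+ 1)) i<j+1))

  i≤j⇒i<j+1 : ∀ {i j} → i ℤ.≤ j → i ℤ.< j ℤ.+ + 1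
  i≤j⇒i<j+1 {i} {j} i≤j = ℤP.suc[i]≤j⇒i<j (subst (+ 1 ℤ.+ i ℤ.≤_) (ℤP.+-comm (+ 1) j) (ℤP.+-monoʳ-≤ (+ 1) i≤j))

module IntegerEmbedding where

  open IntegerOrder

  ι-≃ : ∀ k → toℚᵘ (ι k) ℚᵘ.≃ mkℚᵘ k 0
  ι-≃ k = ℚP.toℚᵘ-fromℚᵘ (mkℚᵘ k 0)

  ι-mono-< : ∀ {i j} → i ℤ.< j → ι i ℚ.< ι j
  ι-mono-< {i} {j} i<j = ℚP.toℚᵘ-cancel-<
    (ℚᵘP.<-respˡ-≃ (ℚᵘP.≃-sym (ι-≃ i)) (ℚᵘP.<-respʳ-≃ (ℚᵘP.≃-sym (ι-≃ j))
      (*<* (subst₂ ℤ._<_ (sym (ℤP.*-identityʳ i)) (sym (ℤP.*-identityʳ j)) i<j))))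

  ι-cancel-< : ∀ {i j} → ι i ℚ.< ι j → i ℤ.< j
  ι-cancel-< {i} {j} h with ℚᵘP.<-respˡ-≃ (ι-≃ i) (ℚᵘP.<-respʳ-≃ (ι-≃ j) (ℚP.toℚᵘ-mono-< h))
  ... | *<* i<j = subst₂ ℤ._<_ (ℤP.*-identityʳ i) (ℤP.*-identityʳ j) i<j

  ι-mono-≤ : ∀ {i j} → i ℤ.≤ j → ι i ℚ.≤ ι j
  ι-mono-≤ {i} {j} i≤j = ℚP.toℚᵘ-cancel-≤
    (ℚᵘP.≤-respˡ-≃ (ℚᵘP.≃-sym (ι-≃ i)) (ℚᵘP.≤-respʳ-≃ (ℚᵘP.≃-sym (ι-≃ j))
      (*≤* (subst₂ ℤ._≤_ (sym (ℤP.*-identityʳ i)) (sym (ℤP.*-identityʳ j)) i≤j))))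

  ι-cancel-≤ : ∀ {i j} → ι i ℚ.≤ ι j → i ℤ.≤ j
  ι-cancel-≤ {i} {j} h with ℚᵘP.≤-respˡ-≃ (ι-≃ i) (ℚᵘP.≤-respʳ-≃ (ι-≃ j) (ℚP.toℚᵘ-mono-≤ h))
  ... | *≤* i≤j = subst₂ ℤ._≤_ (ℤP.*-identityʳ i) (ℤP.*-identityʳ j) i≤j

  ι-injective : ∀ {i j} → ι i ≡ ι j → i ≡ j
  ι-injective e = ℤP.≤-antisym (ι-cancel-≤ (ℚP.≤-reflexive e)) (ι-cancel-≤ (ℚP.≤-reflexive (sym e)))

  ι-homo-+ : ∀ i j → ι (i ℤ.+ j) ≡ ι i ℚ.+ ι j
  ι-homo-+ i j = ℚP.toℚᵘ-injective (ℚᵘP.≃-trans (ι-≃ (i ℤ.+ j))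
    (ℚᵘP.≃-trans (*≡* (cong₂ (λ x y → (x ℤ.+ y) ℤ.* + 1) (sym (ℤP.*-identityʳ i)) (sym (ℤP.*-identityʳ j))))
      (ℚᵘP.≃-sym (ℚᵘP.≃-trans (ℚP.toℚᵘ-homo-+ (ι i) (ι j)) (ℚᵘP.+-cong (ι-≃ i) (ι-≃ j))))))

  ι-homo-* : ∀ i j → ι (i ℤ.* j) ≡ ι i ℚ.* ι j
  ι-homo-* i j = ℚP.toℚᵘ-injective (ℚᵘP.≃-trans (ι-≃ (i ℤ.* j))
    (ℚᵘP.≃-sym (ℚᵘP.≃-trans (ℚP.toℚᵘ-homo-* (ι i) (ι j)) (ℚᵘP.*-cong (ι-≃ i) (ι-≃ j)))))

  ι-homo-‿- : ∀ i → ι (ℤ.- i) ≡ ℚ.- ι i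
  ι-homo-‿- i = ℚP.toℚᵘ-injective (ℚᵘP.≃-trans (ι-≃ (ℤ.- i))
    (ℚᵘP.≃-sym (ℚᵘP.≃-trans (ℚP.toℚᵘ-homo‿- (ι i)) (ℚᵘP.-‿cong (ι-≃ i)))))

  ι-homo-sub : ∀ i j → ι (i ℤ.- j) ≡ ι i ℚ.- ι j
  ι-homo-sub i j = trans (ι-homo-+ i (ℤ.- j)) (cong (ι i ℚ.+_) (ι-homo-‿- j))

  ι-strictly-between⇒≢ : ∀ {i v} k → ι i ℚ.< v → v ℚ.< ι (i ℤ.+ + 1) → v ≢ ι k
  ι-strictly-between⇒≢ {i} k i<v v<i+1 refl =
    ℤP.<⇒≱ (ι-cancel-< {i} {k} i<v) (i<j+1⇒i≤j (ι-cancel-< {k} {i ℤ.+ + 1} v<i+1))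

module Segment where

  open import Data.Rational using (_+_; _-_; _*_; -_; _<_; _≤_)
  open import Data.Rational.Solver using (module +-*-Solver)
  open +-*-Solver using (solve; _:+_; _:-_; _:*_; :-_; _:=_; con)

  lerp : ℚ → ℚ → ℚ → ℚ
  lerp u v t = u + t * (v - u)

  segment : ∀ {n} → Pt n → Pt n → ℚ → Pt n
  segment x y t i = lerp (x i) (y i) t

  p<q⇒0<q-p : ∀ {p q} → p < q → 0ℚ < q - p
  p<q⇒0<q-p {p} {q} h = subst (_< q - p) (ℚP.+-inverseʳ p) (ℚP.+-monoˡ-< (- p) h)

  p≤q⇒0≤q-p : ∀ {p q} → p ≤ q → 0ℚ ≤ q - p
  p≤q⇒0≤q-p {p} {q} h = subst (_≤ q - p) (ℚP.+-inverseʳ p) (ℚP.+-monoˡ-≤ (- p) h)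

  0≤p∧0≤q⇒0≤p*q : ∀ {p q} → 0ℚ ≤ p → 0ℚ ≤ q → 0ℚ ≤ p * q
  0≤p∧0≤q⇒0≤p*q {p} {q} 0≤p 0≤q =
    subst (_≤ p * q) (ℚP.*-zeroˡ q) (ℚP.*-monoʳ-≤-nonNeg q {{ℚ.nonNegative 0≤q}} 0≤p)

  0<p∧0<q⇒0<p*q : ∀ {p q} → 0ℚ < p → 0ℚ < q → 0ℚ < p * q
  0<p∧0<q⇒0<p*q {p} {q} 0<p 0<q =
    subst (_< p * q) (ℚP.*-zeroˡ q) (ℚP.*-monoˡ-<-pos q {{ℚ.positive 0<q}} 0<p)

  ≤∧≢⇒< : ∀ {p q} → p ≤ q → p ≢ q → p < q
  ≤∧≢⇒< {p} {q} p≤q p≢q with p ℚP.<? q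
  ... | yes p<q = p<q
  ... | no p≮q = ⊥-elim (p≢q (ℚP.≤-antisym p≤q (ℚP.≮⇒≥ p≮q)))

  -- lerp u v t - lo = (1 - t) (u - lo) + t (v - lo), a nonnegative plus a positive term.
  lerp-lower : ∀ {lo u v t} → lo ≤ u → lo < v → 0ℚ < t → t ≤ 1ℚ → lo < lerp u v t
  lerp-lower {lo} {u} {v} {t} lo≤u lo<v 0<t t≤1 =
    subst₂ _<_ (ℚP.+-identityʳ lo) (identity lo u v t)
      (ℚP.+-monoʳ-< lo (subst (_< (1ℚ - t) * (u - lo) + t * (v - lo)) (ℚP.+-identityˡ 0ℚ)
        (ℚP.+-mono-≤-< (0≤p∧0≤q⇒0≤p*q (p≤q⇒0≤q-p t≤1) (p≤q⇒0≤q-p lo≤u))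
                       (0<p∧0<q⇒0<p*q 0<t (p<q⇒0<q-p lo<v)))))
    where
    identity : ∀ lo u v t → lo + ((1ℚ - t) * (u - lo) + t * (v - lo)) ≡ lerp u v t
    identity = solve 4 (λ lo u v t → lo :+ ((con 1ℚ :- t) :* (u :- lo) :+ t :* (v :- lo)) := u :+ t :* (v :- u)) refl

  lerp-upper : ∀ {hi u v t} → u ≤ hi → v < hi → 0ℚ < t → t ≤ 1ℚ → lerp u v t < hi
  lerp-upper {hi} {u} {v} {t} u≤hi v<hi 0<t t≤1 =
    subst₂ _<_ (identity hi u v t) (ℚP.+-identityʳ hi)
      (ℚP.+-monoʳ-< hi (ℚP.neg-antimono-< (subst (_< (1ℚ - t) * (hi - u) + t * (hi - v)) (ℚP.+-identityˡ 0ℚ)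
        (ℚP.+-mono-≤-< (0≤p∧0≤q⇒0≤p*q (p≤q⇒0≤q-p t≤1) (p≤q⇒0≤q-p u≤hi))
                       (0<p∧0<q⇒0<p*q 0<t (p<q⇒0<q-p v<hi))))))
    where
    identity : ∀ hi u v t → hi + - ((1ℚ - t) * (hi - u) + t * (hi - v)) ≡ lerp u v t
    identity = solve 4 (λ hi u v t → hi :+ :- ((con 1ℚ :- t) :* (hi :- u) :+ t :* (hi :- v)) := u :+ t :* (v :- u)) refl

  small-multiple : ∀ {d} e → 0ℚ < d → ∃ λ t → 0ℚ < t × t ≤ 1ℚ × t * e < d
  small-multiple {d} e 0<d with e ℚP.≤? 0ℚ
  ... | yes e≤0 = 1ℚ , ℚP.positive⁻¹ 1ℚ , ℚP.≤-refl ,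
                  subst (_< d) (sym (ℚP.*-identityˡ e)) (ℚP.≤-<-trans e≤0 0<d)
  ... | no e≰0 = t , 0<t , t≤1 , te<d
    where
    s = d + e
    0<s : 0ℚ < s
    0<s = subst (_< s) (ℚP.+-identityˡ 0ℚ) (ℚP.+-mono-< 0<d (ℚP.≰⇒> e≰0))
    instance
      s-pos : ℚ.Positive s
      s-pos = ℚ.positive 0<s
      s-nonZero : ℚ.NonZero s
      s-nonZero = ℚP.pos⇒nonZero s
    t = d * ℚ.1/ s
    ts≡d : t * s ≡ d
    ts≡d = trans (ℚP.*-assoc d _ s) (trans (cong (d *_) (ℚP.*-inverseˡ s)) (ℚP.*-identityʳ d))
    0<t : 0ℚ < t
    0<t = 0<p∧0<q⇒0<p*q 0<d (ℚP.positive⁻¹ _ {{ℚP.1/pos⇒pos s}})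
    t≤1 : t ≤ 1ℚ
    t≤1 = ℚP.*-cancelʳ-≤-pos s (subst₂ _≤_ (sym ts≡d) (sym (ℚP.*-identityˡ s))
            (subst (_≤ s) (ℚP.+-identityʳ d) (ℚP.+-monoʳ-≤ d (ℚP.<⇒≤ (ℚP.≰⇒> e≰0)))))
    distrib : ∀ t d e → t * e + t * d ≡ t * (d + e)
    distrib = solve 3 (λ t d e → t :* e :+ t :* d := t :* (d :+ e)) refl
    te<d : t * e < d
    te<d = subst₂ _<_ (ℚP.+-identityʳ (t * e)) (trans (distrib t d e) ts≡d)
             (ℚP.+-monoʳ-< (t * e) (0<p∧0<q⇒0<p*q 0<t 0<d))

  lerp-closure : ∀ {u v c} → (∀ t → 0ℚ < t → t ≤ 1ℚ → c ≤ lerp u v t) → c ≤ u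
  lerp-closure {u} {v} {c} H with c ℚP.≤? u
  ... | yes c≤u = c≤u
  ... | no c≰u with small-multiple (v - u) (p<q⇒0<q-p (ℚP.≰⇒> c≰u))
  ...   | t , 0<t , t≤1 , t[v-u]<c-u =
    ⊥-elim (ℚP.<-irrefl refl (ℚP.≤-<-trans (H t 0<t t≤1)
      (subst (lerp u v t <_) (cancel u c) (ℚP.+-monoʳ-< u t[v-u]<c-u))))
    where
    cancel : ∀ u c → u + (c - u) ≡ c
    cancel = solve 2 (λ u c → u :+ (c :- u) := c) refl

  lerp-same : ∀ u t → lerp u u t ≡ u
  lerp-same = solve 2 (λ u t → u :+ t :* (u :- u) := u) refl

  pair-segment : ∀ {n} (x y : Pt n) t a b → pair (segment x y t) a b ≡ lerp (pair x a b) (pair y a b) t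
  pair-segment x y t a b = identity (x a) (x b) (y a) (y b) t
    where
    identity : ∀ xa xb ya yb t → lerp xa ya t - lerp xb yb t ≡ lerp (xa - xb) (ya - yb) t
    identity = solve 5 (λ xa xb ya yb t →
      (xa :+ t :* (ya :- xa)) :- (xb :+ t :* (yb :- xb)) := (xa :- xb) :+ t :* ((ya :- yb) :- (xa :- xb))) refl

  sum-segment : ∀ {n} (x y : Pt n) t → sumℚ (segment x y t) ≡ lerp (sumℚ x) (sumℚ y) t
  sum-segment {zero} x y t = solve 1 (λ t → con 0ℚ := con 0ℚ :+ t :* (con 0ℚ :- con 0ℚ)) refl t
  sum-segment {suc n} x y t
    rewrite sum-segment (λ i → x (Fin.suc i)) (λ i → y (Fin.suc i)) t =
    identity (x Fin.zero) (y Fin.zero) (sumℚ (λ i → x (Fin.suc i))) (sumℚ (λ i → y (Fin.suc i))) t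
    where
    identity : ∀ x₀ y₀ X Y t → lerp x₀ y₀ t + lerp X Y t ≡ lerp (x₀ + X) (y₀ + Y) t
    identity = solve 5 (λ x₀ y₀ X Y t →
      x₀ :+ t :* (y₀ :- x₀) :+ (X :+ t :* (Y :- X)) := x₀ :+ X :+ t :* (y₀ :+ Y :- (x₀ :+ X))) refl

sumℤ : ∀ {n} → (Fin n → ℤ) → ℤ
sumℤ {zero}  f = + 0
sumℤ {suc n} f = f Fin.zero ℤ.+ sumℤ (λ i → f (Fin.suc i))

sumℤ-affine : ∀ {n} (f : Fin n → ℤ) c d → sumℤ (λ a → c ℤ.- d ℤ.* f a) ≡ + n ℤ.* c ℤ.- d ℤ.* sumℤ f
sumℤ-affine {zero} f c d = identity c d
  where
  open import Data.Integer.Tactic.RingSolver using (solve-∀)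
  identity : ∀ c d → + 0 ≡ + 0 ℤ.* c ℤ.- d ℤ.* + 0
  identity = solve-∀
sumℤ-affine {suc n} f c d rewrite sumℤ-affine (λ i → f (Fin.suc i)) c d =
  identity c d (f Fin.zero) (sumℤ (λ i → f (Fin.suc i))) (+ n)
  where
  open import Data.Integer.Tactic.RingSolver using (solve-∀)
  identity : ∀ c d x s n → c ℤ.- d ℤ.* x ℤ.+ (n ℤ.* c ℤ.- d ℤ.* s) ≡ (+ 1 ℤ.+ n) ℤ.* c ℤ.- d ℤ.* (x ℤ.+ s)
  identity = solve-∀

-- ⟨point p , e_a - e_b⟩ = (p b - p a) / n, and the common term Σ p puts the point in V.
module Points (n-1 : ℕ) where

  open IntegerEmbedding
  open import Data.Integer.Tactic.RingSolver using (solve-∀)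
  open import Data.Rational.Solver using (module +-*-Solver)

  n : ℕ
  n = suc n-1

  private
    r : ℚ
    r = + 1 ℚ./ (n ℕ.* n)

    instance
      r-pos : ℚ.Positive r
      r-pos = ℚP.normalize-pos 1 (n ℕ.* n)

    ι[n*n]*r≡1 : ι (+ (n ℕ.* n)) ℚ.* r ≡ 1ℚ
    ι[n*n]*r≡1 = ℚP.toℚᵘ-injective (ℚᵘP.≃-trans (ℚP.toℚᵘ-homo-* (ι (+ (n ℕ.* n))) r)
      (ℚᵘP.≃-trans (ℚᵘP.*-cong (ι-≃ (+ (n ℕ.* n))) (ℚP.toℚᵘ-fromℚᵘ (mkℚᵘ (+ 1) (ℕ.pred (n ℕ.* n)))))
        (*≡* (cong (λ x → + suc x) (identity (n-1 ℕ.+ n-1 ℕ.* n))))))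
      where
      identity : ∀ x → x ℕ.* 1 ℕ.* 1 ≡ x ℕ.+ 0 ℕ.* suc x ℕ.+ 0 ℕ.* suc (x ℕ.+ 0 ℕ.* suc x)
      identity = Data.Nat.Tactic.RingSolver.solve-∀
        where import Data.Nat.Tactic.RingSolver

    ι≡ι[n*[k*n]]*r : ∀ k → ι k ≡ ι (+ n ℤ.* (k ℤ.* + n)) ℚ.* r
    ι≡ι[n*[k*n]]*r k = sym (begin
      ι (+ n ℤ.* (k ℤ.* + n)) ℚ.* r  ≡⟨ cong (λ z → ι z ℚ.* r) (identity k (+ n)) ⟩
      ι (k ℤ.* + (n ℕ.* n)) ℚ.* r    ≡⟨ cong (ℚ._* r) (ι-homo-* k (+ (n ℕ.* n))) ⟩
      ι k ℚ.* ι (+ (n ℕ.* n)) ℚ.* r  ≡⟨ ℚP.*-assoc (ι k) _ r ⟩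
      ι k ℚ.* (ι (+ (n ℕ.* n)) ℚ.* r) ≡⟨ cong (ι k ℚ.*_) ι[n*n]*r≡1 ⟩
      ι k ℚ.* 1ℚ                     ≡⟨ ℚP.*-identityʳ (ι k) ⟩
      ι k                            ∎)
      where
      open ≡-Reasoning
      identity : ∀ k n → n ℤ.* (k ℤ.* n) ≡ k ℤ.* (n ℤ.* n)
      identity = solve-∀

    sumℚ-scaled : ∀ {m} (f : Fin m → ℤ) → sumℚ (λ a → ι (f a) ℚ.* r) ≡ ι (sumℤ f) ℚ.* r
    sumℚ-scaled {zero} f = sym (ℚP.*-zeroˡ r)
    sumℚ-scaled {suc m} f rewrite sumℚ-scaled (λ i → f (Fin.suc i)) =
      trans (sym (ℚP.*-distribʳ-+ r (ι (f Fin.zero)) (ι (sumℤ (λ i → f (Fin.suc i))))))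
            (cong (ℚ._* r) (sym (ι-homo-+ (f Fin.zero) _)))

  point : (Fin n → ℤ) → Pt n
  point p a = ι (sumℤ p ℤ.- + n ℤ.* p a) ℚ.* r

  point-InV : ∀ p → InV (point p)
  point-InV p = begin
    sumℚ (point p)                                 ≡⟨ sumℚ-scaled (λ a → sumℤ p ℤ.- + n ℤ.* p a) ⟩
    ι (sumℤ (λ a → sumℤ p ℤ.- + n ℤ.* p a)) ℚ.* r  ≡⟨ cong (λ z → ι z ℚ.* r) (sumℤ-affine p (sumℤ p) (+ n)) ⟩
    ι (+ n ℤ.* sumℤ p ℤ.- + n ℤ.* sumℤ p) ℚ.* r    ≡⟨ cong (λ z → ι z ℚ.* r) (ℤP.+-inverseʳ (+ n ℤ.* sumℤ p)) ⟩
    ι (+ 0) ℚ.* r                                  ≡⟨ ℚP.*-zeroˡ r ⟩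
    0ℚ                                             ∎
    where open ≡-Reasoning

  private
    pair-point : ∀ p a b → pair (point p) a b ≡ ι (+ n ℤ.* (p b ℤ.- p a)) ℚ.* r
    pair-point p a b = begin
      ι X ℚ.* r ℚ.- ι Y ℚ.* r  ≡⟨ *-distribʳ-sub (ι X) (ι Y) r ⟩
      (ι X ℚ.- ι Y) ℚ.* r      ≡⟨ cong (ℚ._* r) (sym (ι-homo-sub X Y)) ⟩
      ι (X ℤ.- Y) ℚ.* r        ≡⟨ cong (λ z → ι z ℚ.* r) (identity (sumℤ p) (+ n) (p a) (p b)) ⟩
      ι (+ n ℤ.* (p b ℤ.- p a)) ℚ.* r ∎
      where
      open ≡-Reasoning
      open +-*-Solver using (solve; _:*_; _:-_; _:=_)
      X = sumℤ p ℤ.- + n ℤ.* p a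
      Y = sumℤ p ℤ.- + n ℤ.* p b
      identity : ∀ s n x y → (s ℤ.- n ℤ.* x) ℤ.- (s ℤ.- n ℤ.* y) ≡ n ℤ.* (y ℤ.- x)
      identity = solve-∀
      *-distribʳ-sub : ∀ x y r → x ℚ.* r ℚ.- y ℚ.* r ≡ (x ℚ.- y) ℚ.* r
      *-distribʳ-sub = solve 3 (λ x y r → x :* r :- y :* r := (x :- y) :* r) refl

  ι<pair-point : ∀ p a b {k} → k ℤ.* + n ℤ.< p b ℤ.- p a → ι k ℚ.< pair (point p) a b
  ι<pair-point p a b {k} h = subst₂ ℚ._<_ (sym (ι≡ι[n*[k*n]]*r k)) (sym (pair-point p a b))
    (ℚP.*-monoˡ-<-pos r (ι-mono-< (ℤP.*-monoˡ-<-pos (+ n) h)))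

  pair-point<ι : ∀ p a b {k} → p b ℤ.- p a ℤ.< k ℤ.* + n → pair (point p) a b ℚ.< ι k
  pair-point<ι p a b {k} h = subst₂ ℚ._<_ (sym (pair-point p a b)) (sym (ι≡ι[n*[k*n]]*r k))
    (ℚP.*-monoˡ-<-pos r (ι-mono-< (ℤP.*-monoˡ-<-pos (+ n) h)))

  pair-point≡ι : ∀ p a b {k} → p b ℤ.- p a ≡ k ℤ.* + n → pair (point p) a b ≡ ι k
  pair-point≡ι p a b {k} e =
    trans (pair-point p a b) (trans (cong (λ z → ι (+ n ℤ.* z) ℚ.* r) e) (sym (ι≡ι[n*[k*n]]*r k)))

A0-point : ∀ n-1 → InA0 (Points.point n-1 (λ a → + toℕ a))
A0-point n-1 = point-InV idp , simple , highest
  where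
  open Points n-1
  idp : Fin n → ℤ
  idp a = + toℕ a
  simple : ∀ (a b : Fin n) → toℕ b ≡ suc (toℕ a) → 0ℚ ℚ.< pair (point idp) a b
  simple a b b≡ = ι<pair-point idp a b {+ 0}
    (subst (+ 0 ℤ.<_) (sym (trans (cong (λ i → + i ℤ.- + toℕ a) b≡) (suc-minus (toℕ a)))) (ℤ.+<+ (ℕ.s≤s ℕ.z≤n)))
    where
    open import Data.Integer.Tactic.RingSolver using (solve-∀)
    identity : ∀ t → + 1 ℤ.+ t ℤ.- t ≡ + 1
    identity = solve-∀
    suc-minus : ∀ t → + suc t ℤ.- + t ≡ + 1
    suc-minus t = trans (cong (ℤ._- + t) (ℤP.pos-+ 1 t)) (identity (+ t))
  highest : ∀ (a b : Fin n) → toℕ a ≡ 0 → suc (toℕ b) ≡ n → pair (point idp) a b ℚ.< 1ℚ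
  highest a b a≡0 _ = pair-point<ι idp a b {+ 1}
    (subst (ℤ._< + 1 ℤ.* + n) (sym (trans (cong (λ i → + toℕ b ℤ.- + i) a≡0) (ℤP.+-identityʳ (+ toℕ b))))
      (ℤ.+<+ (subst (toℕ b ℕ.<_) (sym (ℕP.*-identityˡ n)) (FinP.toℕ<n b))))

module YoungDiagram where

  open import Data.Nat
  open import Data.Nat.Properties
  open import Data.Nat.Tactic.RingSolver using (solve-∀)
  open import Data.List.Relation.Unary.Linked.Properties using (Linked⇒All)

  col-∷-< : ∀ {j r} rs → j < r → col (r ∷ rs) j ≡ suc (col rs j)
  col-∷-< {j} {r} rs j<r with j <? r
  ... | yes _  = refl
  ... | no j≮r = ⊥-elim (j≮r j<r)

  col-∷-≮ : ∀ {j r} rs → ¬ j < r → col (r ∷ rs) j ≡ col rs j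
  col-∷-≮ {j} {r} rs j≮r with j <? r
  ... | yes j<r = ⊥-elim (j≮r j<r)
  ... | no _    = refl

  Linked⇒All≤head : ∀ {r rs} → Linked _≥_ (r ∷ rs) → All (_≤ r) rs
  Linked⇒All≤head L = All.tail (Linked⇒All (λ x≥y y≥z → ≤-trans y≥z x≥y) ≤-refl L)

  row-≤ : ∀ {b} λ′ k → All (_≤ b) λ′ → row λ′ k ≤ b
  row-≤ []       k       _        = z≤n
  row-≤ (r ∷ rs) zero    (r≤b ∷ _) = r≤b
  row-≤ (r ∷ rs) (suc k) (_ ∷ rs≤b) = row-≤ rs k rs≤b

  row≤row0 : ∀ λ′ k → Linked _≥_ λ′ → row λ′ k ≤ row λ′ 0
  row≤row0 []       k       L = ≤-refl
  row≤row0 (r ∷ rs) zero    L = ≤-refl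
  row≤row0 (r ∷ rs) (suc k) L = row-≤ rs k (Linked⇒All≤head L)

  0<row : ∀ λ′ {k} → All (0 <_) λ′ → k < length λ′ → 0 < row λ′ k
  0<row (r ∷ rs) {zero}  (0<r ∷ _)   _         = 0<r
  0<row (r ∷ rs) {suc k} (_ ∷ 0<rs) (s≤s k<ℓ) = 0<row rs 0<rs k<ℓ

  0<row0⇒0<length : ∀ λ′ → 0 < row λ′ 0 → 0 < length λ′
  0<row0⇒0<length (r ∷ rs) _ = s≤s z≤n

  col≡0 : ∀ {j} λ′ → All (_≤ j) λ′ → col λ′ j ≡ 0
  col≡0 []       _              = refl
  col≡0 (r ∷ rs) (r≤j ∷ rs≤j) = trans (col-∷-≮ rs (≤⇒≯ r≤j)) (col≡0 rs rs≤j)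

  col≤length : ∀ λ′ j → col λ′ j ≤ length λ′
  col≤length []       j = z≤n
  col≤length (r ∷ rs) j with j <? r
  ... | yes _ = s≤s (col≤length rs j)
  ... | no _  = m≤n⇒m≤1+n (col≤length rs j)

  col0≡length : ∀ λ′ → All (0 <_) λ′ → col λ′ 0 ≡ length λ′
  col0≡length []       _            = refl
  col0≡length (r ∷ rs) (0<r ∷ 0<rs) = trans (col-∷-< rs 0<r) (cong suc (col0≡length rs 0<rs))

  <col⇒<row : ∀ λ′ {j k} → Linked _≥_ λ′ → k < col λ′ j → j < row λ′ k
  <col⇒<row [] _ ()
  <col⇒<row (r ∷ rs) {j} {k} L k<c with j <? r
  <col⇒<row (r ∷ rs) {j} {zero}  L _         | yes j<r = j<r
  <col⇒<row (r ∷ rs) {j} {suc k} L (s≤s k<c) | yes _   = <col⇒<row rs (Linked.tail L) k<c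
  ... | no j≮r = ⊥-elim (n≮0 (subst (k <_)
          (col≡0 rs (All.map (λ x≤r → ≤-trans x≤r (≮⇒≥ j≮r)) (Linked⇒All≤head L))) k<c))

  <row⇒<col : ∀ λ′ {j k} → Linked _≥_ λ′ → j < row λ′ k → k < col λ′ j
  <row⇒<col [] {k = zero}  _ ()
  <row⇒<col [] {k = suc k} _ ()
  <row⇒<col (r ∷ rs) {j} {zero} L j<r = subst (0 <_) (sym (col-∷-< rs j<r)) (s≤s z≤n)
  <row⇒<col (r ∷ rs) {j} {suc k} L j<row with j <? r
  ... | yes _  = s≤s (<row⇒<col rs (Linked.tail L) j<row)
  ... | no j≮r = ⊥-elim (j≮r (<-≤-trans j<row (row-≤ rs k (Linked⇒All≤head L))))

  hook+coords≡row+col : ∀ λ′ {j k} → j < row λ′ k → k < col λ′ j →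
           hook λ′ k j + suc j + suc k ≡ row λ′ k + col λ′ j + 1
  hook+coords≡row+col λ′ {j} {k} j<r k<c = begin
    (r ∸ suc j) + (c ∸ suc k) + 1 + suc j + suc k      ≡⟨ identity (r ∸ suc j) (c ∸ suc k) (suc j) (suc k) ⟩
    ((r ∸ suc j) + suc j) + ((c ∸ suc k) + suc k) + 1  ≡⟨ cong₂ (λ x y → x + y + 1) (m∸n+n≡m j<r) (m∸n+n≡m k<c) ⟩
    r + c + 1                                          ∎
    where
    open ≡-Reasoning
    r = row λ′ k
    c = col λ′ j
    identity : ∀ a b x y → a + b + 1 + x + y ≡ (a + x) + (b + y) + 1
    identity = solve-∀

  first-column-hook+index≡row+length : ∀ λ′ {k} → All (0 <_) λ′ → k < length λ′ →
                                       hook λ′ k 0 + suc k ≡ row λ′ k + length λ′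
  first-column-hook+index≡row+length λ′ {k} pos k<ℓ = +-cancelʳ-≡ 1 _ _ (begin
    hook λ′ k 0 + suc k + 1     ≡⟨ swap (hook λ′ k 0) (suc k) ⟩
    hook λ′ k 0 + 1 + suc k     ≡⟨ hook+coords≡row+col λ′ (0<row λ′ pos k<ℓ) k<col0 ⟩
    row λ′ k + col λ′ 0 + 1     ≡⟨ cong (λ c → row λ′ k + c + 1) (col0≡length λ′ pos) ⟩
    row λ′ k + length λ′ + 1    ∎)
    where
    open ≡-Reasoning
    k<col0 = subst (k <_) (sym (col0≡length λ′ pos)) k<ℓ
    swap : ∀ h x → h + x + 1 ≡ h + 1 + x
    swap = solve-∀

  first-column-hook≤hook₀₀ : ∀ λ′ k → Linked _≥_ λ′ → hook λ′ k 0 ≤ hook λ′ 0 0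
  first-column-hook≤hook₀₀ λ′ k L =
    +-monoˡ-≤ 1 (+-mono-≤ (∸-monoˡ-≤ 1 (row≤row0 λ′ k L)) (∸-monoʳ-≤ (col λ′ 0) (s≤s z≤n)))

module CoreHooks {n : ℕ} {λ′ : List ℕ} (P : IsPartition λ′) (core : IsCore n λ′) where

  open import Data.Nat
  open import Data.Nat.Properties
  open import Data.Nat.Divisibility using (_∣_; ∣-refl)
  open import Data.Nat.Tactic.RingSolver using (solve-∀)
  open import Relation.Binary using (Tri; tri<; tri≈; tri>)
  open YoungDiagram

  private
    pos = proj₁ P
    L   = proj₂ P

  hook≢n : ∀ {k j} → j < row λ′ k → hook λ′ k j ≢ n
  hook≢n j<r h≡n = core _ _ j<r (subst (n ∣_) (sym h≡n) ∣-refl)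

  record LastHookAbove (k j : ℕ) : Set where
    constructor mkLastHookAbove
    field
      j<row   : j < row λ′ k
      n<hook  : n < hook λ′ k j
      is-last : suc j ≡ row λ′ k ⊎ (suc j < row λ′ k × hook λ′ k (suc j) < n)

  lastHookAbove : ∀ {k} d j → row λ′ k ≡ suc (j + d) → n < hook λ′ k j → ∃ (LastHookAbove k)
  lastHookAbove zero j r≡ n<h =
    j , mkLastHookAbove (subst (j <_) (sym (trans r≡ (cong suc (+-identityʳ j)))) (n<1+n j)) n<h
                        (inj₁ (trans (cong suc (sym (+-identityʳ j))) (sym r≡)))
  lastHookAbove {k} (suc d) j r≡ n<h = step (<-cmp (hook λ′ k (suc j)) n)
    where
    1+j<r : suc j < row λ′ k
    1+j<r = subst (suc j <_) (sym r≡) (s≤s (subst (j <_) (sym (+-suc j d)) (s≤s (m≤m+n j d))))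
    step : Tri (hook λ′ k (suc j) < n) (hook λ′ k (suc j) ≡ n) (n < hook λ′ k (suc j)) → ∃ (LastHookAbove k)
    step (tri< h<n _ _)  = j , mkLastHookAbove (<-trans (n<1+n j) 1+j<r) n<h (inj₂ (1+j<r , h<n))
    step (tri≈ _ h≡n _)  = ⊥-elim (hook≢n 1+j<r h≡n)
    step (tri> _ _ n<h′) = lastHookAbove d (suc j) (trans r≡ (cong suc (+-suc j d))) n<h′

  module _ {k j : ℕ} (k<ℓ : k < length λ′) (last-box : LastHookAbove k j) where

    open LastHookAbove last-box

    private
      r  = row λ′ k
      c₁ = col λ′ j
      c₂ = col λ′ (suc j)
      ℓ  = length λ′
      t  = suc j + n + k

      col-next+row≤ : c₂ + r ≤ t
      col-next+row≤ with is-last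
      ... | inj₁ 1+j≡r = begin
        c₂ + r       ≤⟨ +-mono-≤ c₂≤k (≤-reflexive (sym 1+j≡r)) ⟩
        k + suc j    ≤⟨ m≤m+n (k + suc j) n ⟩
        k + suc j + n ≡⟨ identity k (suc j) n ⟩
        t            ∎
        where
        open ≤-Reasoning
        c₂≤k : c₂ ≤ k
        c₂≤k = ≮⇒≥ (λ k<c₂ → <-irrefl 1+j≡r (<col⇒<row λ′ L k<c₂))
        identity : ∀ k j n → k + j + n ≡ j + n + k
        identity = solve-∀
      ... | inj₂ (1+j<r , h<n) = s≤s⁻¹ (begin
        suc (c₂ + r)                               ≡⟨ identity₁ c₂ r ⟩
        r + c₂ + 1                                 ≡⟨ sym (hook+coords≡row+col λ′ 1+j<r (<row⇒<col λ′ L 1+j<r)) ⟩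
        hook λ′ k (suc j) + suc (suc j) + suc k    ≡⟨ identity₂ (hook λ′ k (suc j)) j k ⟩
        suc (hook λ′ k (suc j)) + (suc j + suc k)  ≤⟨ +-monoˡ-≤ (suc j + suc k) h<n ⟩
        n + (suc j + suc k)                        ≡⟨ identity₃ n j k ⟩
        suc t                                      ∎)
        where
        open ≤-Reasoning
        identity₁ : ∀ c r → suc (c + r) ≡ r + c + 1
        identity₁ = solve-∀
        identity₂ : ∀ h j k → h + suc (suc j) + suc k ≡ suc h + (suc j + suc k)
        identity₂ = solve-∀
        identity₃ : ∀ n j k → n + (suc j + suc k) ≡ suc (suc j + n + k)
        identity₃ = solve-∀

      <row+col : t < r + c₁
      <row+col = s≤s⁻¹ (begin
        suc (suc t)                      ≡⟨ identity n j k ⟩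
        suc n + suc j + suc k            ≤⟨ +-monoˡ-≤ (suc k) (+-monoˡ-≤ (suc j) n<hook) ⟩
        hook λ′ k j + suc j + suc k      ≡⟨ hook+coords≡row+col λ′ j<row (<row⇒<col λ′ L j<row) ⟩
        r + c₁ + 1                       ≡⟨ +-comm (r + c₁) 1 ⟩
        suc (r + c₁)                     ∎)
        where
        open ≤-Reasoning
        identity : ∀ n j k → suc (suc (suc j + n + k)) ≡ suc n + suc j + suc k
        identity = solve-∀

      -- The row k′ = k + n − arm(k , j) ends in column j, so its first hook is exactly n shorter.
      k′ = t ∸ r

      k′+r≡t : k′ + r ≡ t
      k′+r≡t = m∸n+n≡m (≤-trans (m≤n+m r c₂) col-next+row≤)

      k′<c₁ : k′ < c₁
      k′<c₁ = +-cancelʳ-< r k′ c₁ (subst₂ _<_ (sym k′+r≡t) (+-comm r c₁) <row+col)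

      c₂≤k′ : c₂ ≤ k′
      c₂≤k′ = +-cancelʳ-≤ r c₂ k′ (subst (c₂ + r ≤_) (sym k′+r≡t) col-next+row≤)

      row-k′ : row λ′ k′ ≡ suc j
      row-k′ = ≤-antisym (≮⇒≥ (λ 1+j<row → <⇒≱ (<row⇒<col λ′ L 1+j<row) c₂≤k′)) (<col⇒<row λ′ L k′<c₁)

      k′<ℓ : k′ < ℓ
      k′<ℓ = <-≤-trans k′<c₁ (col≤length λ′ j)

    first-column-hook-∸n : ∃ λ k′ → k′ < ℓ × hook λ′ k′ 0 + n ≡ hook λ′ k 0
    first-column-hook-∸n = k′ , k′<ℓ , +-cancelʳ-≡ (suc (k′ + r)) _ _ (begin
      hook λ′ k′ 0 + n + suc (k′ + r)   ≡⟨ identity₁ (hook λ′ k′ 0) n k′ r ⟩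
      hook λ′ k′ 0 + suc k′ + (n + r)   ≡⟨ cong (λ x → x + (n + r)) (first-column-hook+index≡row+length λ′ pos k′<ℓ) ⟩
      row λ′ k′ + ℓ + (n + r)           ≡⟨ cong (λ x → x + ℓ + (n + r)) row-k′ ⟩
      suc j + ℓ + (n + r)               ≡⟨ identity₂ j ℓ n r ⟩
      r + ℓ + (suc j + n)               ≡⟨ cong (λ x → x + (suc j + n)) (sym (first-column-hook+index≡row+length λ′ pos k<ℓ)) ⟩
      hook λ′ k 0 + suc k + (suc j + n) ≡⟨ identity₃ (hook λ′ k 0) k j n ⟩
      hook λ′ k 0 + suc t               ≡⟨ cong (λ x → hook λ′ k 0 + suc x) (sym k′+r≡t) ⟩
      hook λ′ k 0 + suc (k′ + r)        ∎)
      where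
      open ≡-Reasoning
      identity₁ : ∀ h n k r → h + n + suc (k + r) ≡ h + suc k + (n + r)
      identity₁ = solve-∀
      identity₂ : ∀ j ℓ n r → suc j + ℓ + (n + r) ≡ r + ℓ + (suc j + n)
      identity₂ = solve-∀
      identity₃ : ∀ h k j n → h + suc k + (suc j + n) ≡ h + suc (suc j + n + k)
      identity₃ = solve-∀

  first-column-hook-closed : ∀ {k} → k < length λ′ → n ≤ hook λ′ k 0 →
                             ∃ λ k′ → k′ < length λ′ × hook λ′ k′ 0 + n ≡ hook λ′ k 0
  first-column-hook-closed {k} k<ℓ n≤h =
    first-column-hook-∸n k<ℓ (proj₂ (lastHookAbove (row λ′ k ∸ 1) 0 (sym (m+[n∸m]≡n 0<r)) n<h))
    where
    0<r = 0<row λ′ pos k<ℓ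
    n<h = ≤∧≢⇒< n≤h (λ n≡h → hook≢n 0<r (sym n≡h))

module QuotientRemainder where

  open import Data.Integer
  open import Data.Integer.Properties
  open import Data.Integer.Tactic.RingSolver using (solve-∀)
  open import Relation.Binary using (tri<; tri≈; tri>)
  open IntegerOrder

  *n+rem-mono-< : ∀ n {a b i i′} → i ℕ.< n → a < b → a * + n + + i < b * + n + + i′
  *n+rem-mono-< n {a} {b} {i} {i′} i<n a<b = begin-strict
    a * + n + + i    <⟨ +-monoʳ-< (a * + n) (+<+ i<n) ⟩
    a * + n + + n    ≡⟨ identity a (+ n) ⟩
    (a + + 1) * + n  ≤⟨ *-monoʳ-≤-nonNeg (+ n) (i<j⇒i+1≤j a<b) ⟩
    b * + n          ≤⟨ i≤i+j (b * + n) (+ i′) ⟩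
    b * + n + + i′   ∎
    where
    open ≤-Reasoning
    identity : ∀ a n → a * n + n ≡ (a + + 1) * n
    identity = solve-∀

  quotRem-injective : ∀ n {a b i i′} → i ℕ.< n → i′ ℕ.< n →
                      a * + n + + i ≡ b * + n + + i′ → a ≡ b × i ≡ i′
  quotRem-injective n {a} {b} {i} {i′} i<n i′<n e with <-cmp a b
  ... | tri< a<b _ _ = ⊥-elim (<-irrefl e (*n+rem-mono-< n i<n a<b))
  ... | tri> _ _ b<a = ⊥-elim (<-irrefl (sym e) (*n+rem-mono-< n i′<n b<a))
  ... | tri≈ _ refl _ = refl , +-injective (begin
    + i                          ≡⟨ identity (a * + n) (+ i) ⟩
    - (a * + n) + (a * + n + + i)  ≡⟨ cong (λ x → - (a * + n) + x) e ⟩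
    - (a * + n) + (a * + n + + i′) ≡⟨ sym (identity (a * + n) (+ i′)) ⟩
    + i′                         ∎)
    where
    open ≡-Reasoning
    identity : ∀ x y → y ≡ - x + (x + y)
    identity = solve-∀

  quotRem-floor : ∀ n {q i} → i ℕ.< n → + q * + n ≤ + (q ℕ.* n ℕ.+ i) × + (q ℕ.* n ℕ.+ i) < (+ q + + 1) * + n
  quotRem-floor n {q} {i} i<n =
    subst (_≤ + (q ℕ.* n ℕ.+ i)) (ℤP.pos-* q n) (+≤+ (ℕP.m≤m+n (q ℕ.* n) i)) ,
    subst (+ (q ℕ.* n ℕ.+ i) <_) (trans (ℤP.pos-+ (q ℕ.* n) n) (trans (cong (_+ + n) (ℤP.pos-* q n)) (identity (+ q) (+ n))))
      (+<+ (ℕP.+-monoʳ-< (q ℕ.* n) i<n))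
    where
    identity : ∀ q n → q * n + n ≡ (q + + 1) * n
    identity = solve-∀

  floor-mono : ∀ n {a b x} → a * + n ≤ x → x < (b + + 1) * + n → a ≤ b
  floor-mono n a*n≤x x<[b+1]*n = i<j+1⇒i≤j (*-cancelʳ-<-nonNeg (+ n) (≤-<-trans a*n≤x x<[b+1]*n))

  floor-unique : ∀ n {a b x} → a * + n ≤ x → x < (a + + 1) * + n → b * + n ≤ x → x < (b + + 1) * + n → a ≡ b
  floor-unique n a*n≤x x<[a+1]*n b*n≤x x<[b+1]*n =
    ≤-antisym (floor-mono n a*n≤x x<[b+1]*n) (floor-mono n b*n≤x x<[a+1]*n)

module Positions (n-1 : ℕ) {λ′ : List ℕ} (P : IsPartition λ′) (core : IsCore (suc n-1) λ′)
                 (level p : Fin (suc n-1) → ℤ)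
                 (level-spec : ∀ i → IsLevel (suc n-1) λ′ (toℕ i) (level i))
                 (p-increasing : ∀ a b → a Fin.< b → p a ℤ.< p b)
                 (level⇒p : ∀ i → Σ (Fin (suc n-1)) λ j → p j ≡ level i ℤ.* + suc n-1 ℤ.+ + toℕ i)
                 (p⇒level : ∀ j → Σ (Fin (suc n-1)) λ i → p j ≡ level i ℤ.* + suc n-1 ℤ.+ + toℕ i) where

  open import Data.Nat using (_+_; _*_; _≤_; _<_; _∸_; s≤s; z≤n)
  open import Data.Nat.DivMod using (_divMod_; result)
  open import Data.Nat.Tactic.RingSolver using (solve-∀)
  open import Relation.Binary using (tri<; tri≈; tri>)
  open QuotientRemainder
  open YoungDiagram
  open CoreHooks P core

  n : ℕ
  n = suc n-1

  last : Fin n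
  last = Fin.fromℕ n-1

  FirstColumnHook : ℕ → Set
  FirstColumnHook h = ∃ λ k → k < length λ′ × hook λ′ k 0 ≡ h

  pos-*-+ : ∀ q i → + q ℤ.* + n ℤ.+ + i ≡ + (q * n + i)
  pos-*-+ q i = cong (ℤ._+ + i) (sym (ℤP.pos-* q n))

  private
    pos = proj₁ P
    L   = proj₂ P

    InB⇒FirstColumnHook : ∀ h → InB λ′ (+ h) → FirstColumnHook h
    InB⇒FirstColumnHook h (inj₁ (ℤ.+<+ ()))
    InB⇒FirstColumnHook h (inj₂ (k , k<ℓ , e)) = k , k<ℓ , sym (ℤP.+-injective e)

    FirstColumnHook⇒InB : ∀ h → FirstColumnHook h → InB λ′ (+ h)
    FirstColumnHook⇒InB h (k , k<ℓ , e) = inj₂ (k , k<ℓ , cong +_ (sym e))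

    one-more-n : ∀ q d i → (q + suc d) * n + i ≡ ((q + d) * n + i) + n
    one-more-n q d i = identity q d n i
      where
      identity : ∀ q d n i → (q + suc d) * n + i ≡ ((q + d) * n + i) + n
      identity = solve-∀

    regroup : ∀ l q i → l ℤ.* + n ℤ.+ i ℤ.+ q ℤ.* + n ≡ (l ℤ.+ q) ℤ.* + n ℤ.+ i
    regroup l q i = identity l q (+ n) i
      where
      open import Data.Integer.Tactic.RingSolver using () renaming (solve-∀ to solveℤ)
      identity : ∀ l q n i → l ℤ.* n ℤ.+ i ℤ.+ q ℤ.* n ≡ (l ℤ.+ q) ℤ.* n ℤ.+ i
      identity = solveℤ

  level-nonNeg : ∀ i → ∃ λ q → level i ≡ + q
  level-nonNeg i with level i in eq
  ... | + q      = q , refl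
  ... | -[1+ x ] = ⊥-elim (proj₁ (subst (IsLevel n λ′ (toℕ i)) eq (level-spec i))
                     (inj₁ (*n+rem-mono-< n { -[1+ x ]} {+ 0} {toℕ i} {0} (FinP.toℕ<n i) ℤ.-<+)))

  p-as-level : ∀ j → ∃ λ i → ∃ λ q → level i ≡ + q × p j ≡ + (q * n + toℕ i)
  p-as-level j with p⇒level j
  ... | i , pj≡ with level-nonNeg i
  ...   | q , level≡ = i , q , level≡ , trans pj≡ (trans (cong (λ l → l ℤ.* + n ℤ.+ + toℕ i) level≡) (pos-*-+ q (toℕ i)))

  <level⇒FirstColumnHook : ∀ i q → + q ℤ.< level i → FirstColumnHook (q * n + toℕ i)
  <level⇒FirstColumnHook i q q<level =
    InB⇒FirstColumnHook _ (subst (InB λ′) (pos-*-+ q (toℕ i)) (proj₂ (level-spec i) (+ q) q<level))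

  FirstColumnHook-down : ∀ i d q → FirstColumnHook ((q + d) * n + i) → FirstColumnHook (q * n + i)
  FirstColumnHook-down i zero q h = subst (λ q′ → FirstColumnHook (q′ * n + i)) (ℕP.+-identityʳ q) h
  FirstColumnHook-down i (suc d) q (k , k<ℓ , h≡) =
    FirstColumnHook-down i d q (drop-n (first-column-hook-closed k<ℓ (subst (n ≤_) (sym h≡′) (ℕP.m≤n+m n ((q + d) * n + i)))))
    where
    h≡′ : hook λ′ k 0 ≡ ((q + d) * n + i) + n
    h≡′ = trans h≡ (one-more-n q d i)
    drop-n : (∃ λ k′ → k′ < length λ′ × hook λ′ k′ 0 + n ≡ hook λ′ k 0) → FirstColumnHook ((q + d) * n + i)
    drop-n (k′ , k′<ℓ , e) = k′ , k′<ℓ , ℕP.+-cancelʳ-≡ n _ _ (trans e h≡′)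

  FirstColumnHook⇒<level : ∀ i q → FirstColumnHook (q * n + toℕ i) → ∃ λ qᵢ → level i ≡ + qᵢ × q < qᵢ
  FirstColumnHook⇒<level i q h with level-nonNeg i
  ... | qᵢ , level≡ with q ℕP.<? qᵢ
  ...   | yes q<qᵢ = qᵢ , level≡ , q<qᵢ
  ...   | no q≮qᵢ = ⊥-elim (proj₁ (level-spec i)
          (subst (InB λ′) (sym (trans (cong (λ l → l ℤ.* + n ℤ.+ + toℕ i) level≡) (pos-*-+ qᵢ (toℕ i))))
            (FirstColumnHook⇒InB _ (FirstColumnHook-down (toℕ i) (q ∸ qᵢ) qᵢ
              (subst (λ q′ → FirstColumnHook (q′ * n + toℕ i)) (sym (ℕP.m+[n∸m]≡n (ℕP.≮⇒≥ q≮qᵢ))) h)))))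

  p-zero : p Fin.zero ≡ + 0
  p-zero = ℤP.≤-antisym (ℤP.≤-trans p-zero≤pj (ℤP.≤-reflexive pj≡0)) 0≤p-zero
    where
    level-zero : level Fin.zero ≡ + 0
    level-zero with level-nonNeg Fin.zero
    ... | zero  , level≡ = level≡
    ... | suc q , level≡ with <level⇒FirstColumnHook Fin.zero 0 (subst (+ 0 ℤ.<_) (sym level≡) (ℤ.+<+ (s≤s z≤n)))
    ...   | k , _ , h≡0 = ⊥-elim (ℕP.1+n≢0 (trans (ℕP.+-comm 1 _) h≡0))
    j = proj₁ (level⇒p Fin.zero)
    pj≡0 : p j ≡ + 0
    pj≡0 = trans (proj₂ (level⇒p Fin.zero)) (cong (λ l → l ℤ.* + n ℤ.+ + 0) level-zero)
    p-zero≤pj : p Fin.zero ℤ.≤ p j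
    p-zero≤pj with j
    ... | Fin.zero  = ℤP.≤-refl
    ... | Fin.suc j′ = ℤP.<⇒≤ (p-increasing Fin.zero (Fin.suc j′) (s≤s z≤n))
    0≤p-zero : + 0 ℤ.≤ p Fin.zero
    0≤p-zero with p-as-level Fin.zero
    ... | _ , _ , _ , p≡ = subst (+ 0 ℤ.≤_) (sym p≡) (ℤ.+≤+ z≤n)

  ≡-mod-n⇒≡ : ∀ a b q → p a ≡ p b ℤ.+ q ℤ.* + n → a ≡ b
  ≡-mod-n⇒≡ a b q pa≡ with p⇒level a | p⇒level b
  ... | i , pa≡ᵢ | i′ , pb≡ᵢ′
    with quotRem-injective n {level i} {level i′ ℤ.+ q} (FinP.toℕ<n i) (FinP.toℕ<n i′)
           (trans (sym pa≡ᵢ) (trans pa≡ (trans (cong (ℤ._+ q ℤ.* + n) pb≡ᵢ′) (regroup (level i′) q (+ toℕ i′)))))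
  ... | _ , toℕi≡toℕi′ with FinP.toℕ-injective toℕi≡toℕi′
  ...   | refl with FinP.<-cmp a b
  ...     | tri< a<b _ _ = ⊥-elim (ℤP.<-irrefl (trans pa≡ᵢ (sym pb≡ᵢ′)) (p-increasing a b a<b))
  ...     | tri≈ _ a≡b _ = a≡b
  ...     | tri> _ _ b<a = ⊥-elim (ℤP.<-irrefl (trans pb≡ᵢ′ (sym pa≡ᵢ)) (p-increasing b a b<a))

  p≤p-last : ∀ j → p j ℤ.≤ p last
  p≤p-last j with j Fin.≟ last
  ... | yes refl = ℤP.≤-refl
  ... | no j≢last = ℤP.<⇒≤ (p-increasing j last (FinP.≤∧≢⇒< (FinP.≤fromℕ j) j≢last))

  p-last≤hook₀₀+n : p last ℤ.≤ + (hook λ′ 0 0 + n)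
  p-last≤hook₀₀+n with p-as-level last
  ... | i , zero , _ , p≡ =
    subst (ℤ._≤ _) (sym p≡) (ℤ.+≤+ (ℕP.≤-trans (ℕP.<⇒≤ (FinP.toℕ<n i)) (ℕP.m≤n+m n _)))
  ... | i , suc q , level≡ , p≡ with <level⇒FirstColumnHook i q (subst (+ q ℤ.<_) (sym level≡) (ℤ.+<+ (ℕP.n<1+n q)))
  ...   | k , _ , h≡ = subst (ℤ._≤ _) (sym p≡) (ℤ.+≤+ (begin
    suc q * n + toℕ i    ≡⟨ identity q n (toℕ i) ⟩
    (q * n + toℕ i) + n  ≡⟨ cong (_+ n) (sym h≡) ⟩
    hook λ′ k 0 + n      ≤⟨ ℕP.+-monoˡ-≤ n (first-column-hook≤hook₀₀ λ′ k L) ⟩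
    hook λ′ 0 0 + n      ∎))
    where
    open ℕP.≤-Reasoning
    identity : ∀ q n i → suc q * n + i ≡ (q * n + i) + n
    identity = solve-∀

  hook₀₀+n≤p-last : 0 < length λ′ → + (hook λ′ 0 0 + n) ℤ.≤ p last
  hook₀₀+n≤p-last 0<ℓ with hook λ′ 0 0 divMod n
  ... | result q i h≡ with FirstColumnHook⇒<level i q (0 , 0<ℓ , trans h≡ (ℕP.+-comm (toℕ i) (q * n)))
  ...   | qᵢ , level≡ , q<qᵢ = ℤP.≤-trans (ℤ.+≤+ bound) (ℤP.≤-trans (ℤP.≤-reflexive (sym pj≡)) (p≤p-last j))
    where
    open ℕP.≤-Reasoning
    j = proj₁ (level⇒p i)
    pj≡ : p j ≡ + (qᵢ * n + toℕ i)
    pj≡ = trans (proj₂ (level⇒p i)) (trans (cong (λ l → l ℤ.* + n ℤ.+ + toℕ i) level≡) (pos-*-+ qᵢ (toℕ i)))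
    identity : ∀ i q n → i + q * n + n ≡ suc q * n + i
    identity = solve-∀
    bound : hook λ′ 0 0 + n ≤ qᵢ * n + toℕ i
    bound = begin
      hook λ′ 0 0 + n    ≡⟨ cong (_+ n) h≡ ⟩
      toℕ i + q * n + n  ≡⟨ identity (toℕ i) q n ⟩
      suc q * n + toℕ i  ≤⟨ ℕP.+-monoˡ-≤ (toℕ i) (ℕP.*-monoˡ-≤ n q<qᵢ) ⟩
      qᵢ * n + toℕ i     ∎

  p-last≡hook₀₀+n : 0 < length λ′ → p last ≡ + (hook λ′ 0 0 + n)
  p-last≡hook₀₀+n 0<ℓ = ℤP.≤-antisym p-last≤hook₀₀+n (hook₀₀+n≤p-last 0<ℓ)

  n≤p-last⇒0<length : + n ℤ.≤ p last → 0 < length λ′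
  n≤p-last⇒0<length n≤p with p-as-level last
  ... | i , zero , _ , p≡ = ⊥-elim (ℕP.<⇒≱ (FinP.toℕ<n i) (ℤP.drop‿+≤+ (subst (+ n ℤ.≤_) p≡ n≤p)))
  ... | i , suc q , level≡ , _ with <level⇒FirstColumnHook i q (subst (+ q ℤ.<_) (sym level≡) (ℤ.+<+ (ℕP.n<1+n q)))
  ...   | k , k<ℓ , _ = ℕP.≤-<-trans z≤n k<ℓ

  Hook11⇔p-last : ∀ m → Hook11Is λ′ (n * m + 1) ⇔ (p last ≡ + (n * suc m + 1))
  Hook11⇔p-last m = mk⇔ to from
    where
    shift : n * m + 1 + n ≡ n * suc m + 1
    shift = identity n m
      where
      identity : ∀ n m → n * m + 1 + n ≡ n * suc m + 1
      identity = solve-∀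
    to : Hook11Is λ′ (n * m + 1) → p last ≡ + (n * suc m + 1)
    to (0<r , h≡) = trans (p-last≡hook₀₀+n (0<row0⇒0<length λ′ 0<r)) (trans (cong (λ h → + (h + n)) h≡) (cong +_ shift))
    from : p last ≡ + (n * suc m + 1) → Hook11Is λ′ (n * m + 1)
    from e = 0<row λ′ pos 0<ℓ ,
             ℕP.+-cancelʳ-≡ n _ _ (ℤP.+-injective (trans (sym (p-last≡hook₀₀+n 0<ℓ)) (trans e (cong +_ (sym shift)))))
      where
      0<ℓ = n≤p-last⇒0<length (subst (+ n ℤ.≤_) (sym e) (ℤ.+≤+ (ℕP.≤-trans (ℕP.m≤m*n n (suc m)) (ℕP.m≤m+n _ 1))))

open IntegerOrder
open IntegerEmbedding
open Segment

module Regions {n} (m : ℕ) (x0 : Pt n) where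

  region-same-side : ∀ {y y′ a b k} → InRegion m x0 y → InRegion m x0 y′ → a Fin.< b → ShiLevel m k →
                     pair y a b ℚ.< ι k → pair y′ a b ℚ.< ι k
  region-same-side (_ , _ , side) (_ , _ , side′) a<b k∈ y<k =
    Equivalence.to (side′ _ _ _ a<b k∈) (Equivalence.from (side _ _ _ a<b k∈) y<k)

  closure-above : ∀ {x y y′ a b k} → (∀ t → 0ℚ ℚ.< t → t ℚ.≤ 1ℚ → InRegion m x0 (segment x y t)) →
                  InRegion m x0 y′ → a Fin.< b → ShiLevel m k → ι k ℚ.≤ pair y′ a b → ι k ℚ.≤ pair x a b
  closure-above {x} {y} {y′} {a} {b} {k} seg y′∈ a<b k∈ k≤y′ = lerp-closure {pair x a b} {pair y a b} (λ t 0<t t≤1 →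
    subst (ι k ℚ.≤_) (pair-segment x y t a b)
      (ℚP.≮⇒≥ (λ z<k → ℚP.<-irrefl refl (ℚP.<-≤-trans (region-same-side (seg t 0<t t≤1) y′∈ a<b k∈ z<k) k≤y′))))

alcove-triangle : ∀ {n} {K : Shi n} {x a b c} → InAlcove K x → a Fin.< b → b Fin.< c →
                  K a c ℤ.≤ K a b ℤ.+ K b c ℤ.+ + 1
alcove-triangle {K = K} {x} {a} {b} {c} (_ , bounds) a<b b<c =
  i<j+1⇒i≤j (ι-cancel-< (ℚP.<-trans (proj₁ (bounds a c (FinP.<-trans a<b b<c)))
    (subst₂ ℚ._<_ (telescope (x a) (x b) (x c)) (sym (trans (cong ι (regroup (K a b) (K b c)))
                                                      (ι-homo-+ (K a b ℤ.+ + 1) (K b c ℤ.+ + 1))))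
      (ℚP.+-mono-< (proj₂ (bounds a b a<b)) (proj₂ (bounds b c b<c))))))
  where
  open import Data.Rational.Solver using (module +-*-Solver)
  open +-*-Solver using (solve; _:+_; _:-_; _:=_)
  open import Data.Integer.Tactic.RingSolver using (solve-∀)
  telescope : ∀ xa xb xc → (xa ℚ.- xb) ℚ.+ (xb ℚ.- xc) ≡ xa ℚ.- xc
  telescope = solve 3 (λ xa xb xc → (xa :- xb) :+ (xb :- xc) := xa :- xc) refl
  regroup : ∀ i j → i ℤ.+ j ℤ.+ + 1 ℤ.+ + 1 ≡ (i ℤ.+ + 1) ℤ.+ (j ℤ.+ + 1)
  regroup = solve-∀

ThetaWall : ∀ {n} → ℕ → Pt n → Set
ThetaWall {n} m x0 = Σ (Fin n) λ a → Σ (Fin n) λ b → IsTheta a b × IsSeparatingWall m x0 a b (+ m)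

-- For n = 2 there is a single root: once K_θ ≥ m, the alcove m < ⟨x,θ⟩ < m + 1 lies in R, and
-- minimality gives K_θ ≤ m.
rank-two-θ≤m : ∀ m-1 {x0 : Pt 2} {K : Shi 2} → IsMinimalAlcove (suc m-1) x0 K →
               + suc m-1 ℤ.≤ K Fin.zero (Fin.suc Fin.zero) → K Fin.zero (Fin.suc Fin.zero) ℤ.≤ + suc m-1
rank-two-θ≤m m-1 {x0} {K} ((y , y∈K) , K-in-region , minimal) m≤K =
  subst (ℤ._≤ + m) (ℤP.0≤i⇒+∣i∣≡i (ℤP.≤-trans (ℤ.+≤+ ℕ.z≤n) m≤K))
    (ℤ.+≤+ (subst₂ ℕ._≤_ (twice-+-identityʳ _) (twice-+-identityʳ m) (minimal K′ alcove-K′ K′-in-region)))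
  where
  open Points 1 using (point; point-InV; ι<pair-point; pair-point<ι)
  open import Data.Integer.Tactic.RingSolver using (solve-∀)
  m = suc m-1
  0₂ 1₂ : Fin 2
  0₂ = Fin.zero
  1₂ = Fin.suc Fin.zero
  twice-+-identityʳ : ∀ x → x ℕ.+ 0 ℕ.+ 0 ≡ x
  twice-+-identityʳ x = trans (ℕP.+-identityʳ _) (ℕP.+-identityʳ x)
  K′ : Shi 2
  K′ _ _ = + m
  p′ : Fin 2 → ℤ
  p′ Fin.zero    = + 0
  p′ (Fin.suc _) = + (m ℕ.+ m ℕ.+ 1)
  alcove-K′ : IsAlcove K′
  alcove-K′ = point p′ , point-InV p′ , bounds
    where
    identity₁ : ∀ m → m ℤ.* + 2 ℤ.+ + 1 ≡ m ℤ.+ m ℤ.+ + 1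
    identity₁ = solve-∀
    identity₂ : ∀ m → m ℤ.+ m ℤ.+ + 2 ≡ (m ℤ.+ + 1) ℤ.* + 2
    identity₂ = solve-∀
    bounds : ∀ (a b : Fin 2) → a Fin.< b → ι (K′ a b) ℚ.< pair (point p′) a b × pair (point p′) a b ℚ.< ι (K′ a b ℤ.+ + 1)
    bounds Fin.zero (Fin.suc Fin.zero) _ =
      ι<pair-point p′ 0₂ 1₂ {+ m} (subst₂ ℤ._<_ (ℤP.+-identityʳ (+ m ℤ.* + 2)) (trans (identity₁ (+ m)) (sym (ℤP.+-identityʳ _)))
        (ℤP.+-monoʳ-< (+ m ℤ.* + 2) (ℤ.+<+ (ℕ.s≤s ℕ.z≤n)))) ,
      pair-point<ι p′ 0₂ 1₂ {+ m ℤ.+ + 1} (subst₂ ℤ._<_ (sym (ℤP.+-identityʳ _)) (identity₂ (+ m))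
        (ℤP.+-monoʳ-< (+ m ℤ.+ + m) (ℤ.+<+ {1} {2} (ℕ.s≤s (ℕ.s≤s ℕ.z≤n)))))
    bounds Fin.zero Fin.zero ()
    bounds (Fin.suc Fin.zero) Fin.zero ()
    bounds (Fin.suc Fin.zero) (Fin.suc Fin.zero) (ℕ.s≤s ())
  K′-in-region : AlcoveInRegion m x0 K′
  K′-in-region x (x∈V , bounds) = x∈V , complement , sides
    where
    complement : InComplement m x
    complement Fin.zero (Fin.suc Fin.zero) k 0<1 _ =
      ι-strictly-between⇒≢ {+ m} k (proj₁ (bounds 0₂ 1₂ 0<1)) (proj₂ (bounds 0₂ 1₂ 0<1))
    complement Fin.zero Fin.zero k ()
    complement (Fin.suc Fin.zero) Fin.zero k ()
    complement (Fin.suc Fin.zero) (Fin.suc Fin.zero) k (ℕ.s≤s ())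
    sides : ∀ (a b : Fin 2) (k : ℤ) → a Fin.< b → ShiLevel m k → (pair x0 a b ℚ.< ι k) ⇔ (pair x a b ℚ.< ι k)
    sides Fin.zero (Fin.suc Fin.zero) k 0<1 k∈ = mk⇔ (λ x0<k → ⊥-elim (y-not-below y∈R x0<k)) (λ x<k → ⊥-elim (x-not-below x<k))
      where
      y∈R = K-in-region y y∈K
      k≤m : ι k ℚ.≤ ι (+ m)
      k≤m = ι-mono-≤ (proj₂ k∈)
      x-not-below : ¬ (pair x 0₂ 1₂ ℚ.< ι k)
      x-not-below x<k = ℚP.<-irrefl refl (ℚP.<-≤-trans (ℚP.<-trans (proj₁ (bounds 0₂ 1₂ 0<1)) x<k) k≤m)
      y-not-below : InRegion m x0 y → ¬ (pair x0 0₂ 1₂ ℚ.< ι k)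
      y-not-below (_ , _ , side) x0<k = ℚP.<-irrefl refl (ℚP.<-≤-trans
        (ℚP.≤-<-trans (ι-mono-≤ m≤K) (ℚP.<-trans (proj₁ (proj₂ y∈K 0₂ 1₂ 0<1)) (Equivalence.to (side 0₂ 1₂ k 0<1 k∈) x0<k))) k≤m)
    sides Fin.zero Fin.zero k ()
    sides (Fin.suc Fin.zero) Fin.zero k ()
    sides (Fin.suc Fin.zero) (Fin.suc Fin.zero) k (ℕ.s≤s ())

module Walls (n-2 m-1 : ℕ) {x0 : Pt (suc (suc n-2))} {K : Shi (suc (suc n-2))}
             (K-in-region : AlcoveInRegion (suc m-1) x0 K)
             {λ′ : List ℕ} (P : IsPartition λ′) (core : IsCore (suc (suc n-2)) λ′)
             (level p : Fin (suc (suc n-2)) → ℤ)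
             (level-spec : ∀ i → IsLevel (suc (suc n-2)) λ′ (toℕ i) (level i))
             (p-increasing : ∀ a b → a Fin.< b → p a ℤ.< p b)
             (level⇒p : ∀ i → Σ (Fin (suc (suc n-2))) λ j → p j ≡ level i ℤ.* + suc (suc n-2) ℤ.+ + toℕ i)
             (p⇒level : ∀ j → Σ (Fin (suc (suc n-2))) λ i → p j ≡ level i ℤ.* + suc (suc n-2) ℤ.+ + toℕ i)
             (K-floor : ∀ a b → a Fin.< b → K a b ℤ.* + suc (suc n-2) ℤ.≤ p b ℤ.- p a ×
                                            p b ℤ.- p a ℤ.< (K a b ℤ.+ + 1) ℤ.* + suc (suc n-2)) where

  open Positions (suc n-2) P core level p level-spec p-increasing level⇒p p⇒level
  open Points (suc n-2) using (point; point-InV; ι<pair-point; pair-point<ι; pair-point≡ι)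
  open Regions (suc m-1) x0
  open QuotientRemainder
  open import Data.Integer.Tactic.RingSolver using (solve-∀)

  m : ℕ
  m = suc m-1

  first : Fin n
  first = Fin.zero

  first<last : first Fin.< last
  first<last = subst (0 ℕ.<_) (sym (FinP.toℕ-fromℕ (suc n-2))) (ℕ.s≤s ℕ.z≤n)

  toℕ-last : suc (toℕ last) ≡ n
  toℕ-last = cong suc (FinP.toℕ-fromℕ (suc n-2))

  a<b⇒a≢last : ∀ {a b : Fin n} → a Fin.< b → a ≢ last
  a<b⇒a≢last {b = b} a<b refl = ℕP.<⇒≱ (subst (ℕ._< toℕ b) (FinP.toℕ-fromℕ (suc n-2)) a<b) (ℕ.s≤s⁻¹ (FinP.toℕ<n b))

  0∈ShiLevel : ShiLevel m (+ 0)
  0∈ShiLevel = ℤ.-<+ , ℤ.+≤+ ℕ.z≤n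

  m∈ShiLevel : ShiLevel m (+ m)
  m∈ShiLevel = ℤ.-<+ , ℤP.≤-refl

  K-floor-strict : ∀ a b → a Fin.< b → K a b ℤ.* + n ℤ.< p b ℤ.- p a
  K-floor-strict a b a<b = ℤP.≤∧≢⇒< (proj₁ (K-floor a b a<b)) λ K*n≡ →
    FinP.<-irrefl (sym (≡-mod-n⇒≡ b a (K a b) (trans (identity (p b) (p a)) (cong (λ d → p a ℤ.+ d) (sym K*n≡))))) a<b
    where
    identity : ∀ x y → x ≡ y ℤ.+ (x ℤ.- y)
    identity = solve-∀

  K-nonNeg : ∀ a b → a Fin.< b → + 0 ℤ.≤ K a b
  K-nonNeg a b a<b = floor-mono n {+ 0} {K a b} {p b ℤ.- p a}
    (ℤP.<⇒≤ (subst (ℤ._< p b ℤ.- p a) (ℤP.+-inverseʳ (p a)) (ℤP.+-monoˡ-< (ℤ.- p a) (p-increasing a b a<b))))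
    (proj₂ (K-floor a b a<b))

  point-p-in-alcove : InAlcove K (point p)
  point-p-in-alcove = point-InV p , λ a b a<b →
    ι<pair-point p a b {K a b} (K-floor-strict a b a<b) , pair-point<ι p a b {K a b ℤ.+ + 1} (proj₂ (K-floor a b a<b))

  point-p-in-region : InRegion m x0 (point p)
  point-p-in-region = K-in-region (point p) point-p-in-alcove

  SubrootBound : Set
  SubrootBound = ∀ c → first Fin.< c → c Fin.< last → K first c ℤ.+ K c last ℤ.+ + 1 ℤ.≤ + m

  K-θ≤m-via : ∀ c → first Fin.< c → c Fin.< last → SubrootBound → K first last ℤ.≤ + m
  K-θ≤m-via c first<c c<last bound =
    ℤP.≤-trans (alcove-triangle {K = K} {point p} {first} {c} {last} point-p-in-alcove first<c c<last) (bound c first<c c<last)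

  A0-below-m : ∀ y → InA0 y → pair y first last ℚ.< ι (+ m)
  A0-below-m y (_ , _ , θ<1) = ℚP.<-≤-trans (θ<1 first last refl toℕ-last) (ι-mono-≤ {+ 1} {+ m} (ℤ.+≤+ (ℕ.s≤s ℕ.z≤n)))

  A0-not-above-m : ¬ (∀ y → InA0 y → ι (+ m) ℚ.≤ pair y first last)
  A0-not-above-m above = ℚP.<-irrefl refl (ℚP.≤-<-trans (above y₀ (A0-point (suc n-2))) (A0-below-m y₀ (A0-point (suc n-2))))
    where y₀ = point (λ a → + toℕ a)

  lowered : Fin n → ℤ
  lowered j with j Fin.≟ last
  ... | yes _ = p j ℤ.- + 1
  ... | no _  = p j

  lowered-last : lowered last ≡ p last ℤ.- + 1
  lowered-last with last Fin.≟ last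
  ... | yes _ = refl
  ... | no last≢last = ⊥-elim (last≢last refl)

  lowered-other : ∀ {j} → j ≢ last → lowered j ≡ p j
  lowered-other {j} j≢last with j Fin.≟ last
  ... | yes j≡last = ⊥-elim (j≢last j≡last)
  ... | no _ = refl

  region-above-m : K first last ≡ + m → ∀ y → InRegion m x0 y → ι (+ m) ℚ.≤ pair y first last
  region-above-m K-θ≡m y y∈ = ℚP.≮⇒≥ λ y<m → ℚP.<-asym
    (region-same-side {y} {point p} y∈ point-p-in-region first<last m∈ShiLevel y<m)
    (subst (λ k → ι k ℚ.< pair (point p) first last) K-θ≡m (proj₁ (proj₂ point-p-in-alcove first last first<last)))

  module WallFromPosition (p-last≡ : p last ≡ + (n ℕ.* m ℕ.+ 1)) where

    private
      p-last≡′ : p last ≡ + n ℤ.* + m ℤ.+ + 1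
      p-last≡′ = trans p-last≡ (cong (ℤ._+ + 1) (ℤP.pos-* n m))

      θ-difference : p last ℤ.- p first ≡ + m ℤ.* + n ℤ.+ + 1
      θ-difference = trans (cong₂ ℤ._-_ p-last≡′ p-zero) (trans (ℤP.+-identityʳ _) (identity (+ n) (+ m)))
        where
        identity : ∀ n m → n ℤ.* m ℤ.+ + 1 ≡ m ℤ.* n ℤ.+ + 1
        identity = solve-∀

    K-θ≡m : K first last ≡ + m
    K-θ≡m = floor-unique n (proj₁ (K-floor first last first<last)) (proj₂ (K-floor first last first<last))
      (subst (+ m ℤ.* + n ℤ.≤_) (sym θ-difference) (ℤP.i≤i+j (+ m ℤ.* + n) (+ 1)))
      (subst₂ ℤ._<_ (sym θ-difference) (identity (+ m) (+ n))
        (ℤP.+-monoʳ-< (+ m ℤ.* + n) (ℤ.+<+ {1} {n} (ℕ.s≤s (ℕ.s≤s ℕ.z≤n)))))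
      where
      identity : ∀ m n → m ℤ.* n ℤ.+ n ≡ (m ℤ.+ + 1) ℤ.* n
      identity = solve-∀

    wall-point : Pt n
    wall-point = point lowered

    wall-point-on-θ : OnH wall-point first last (+ m)
    wall-point-on-θ = pair-point≡ι lowered first last {+ m}
      (trans (cong₂ ℤ._-_ lowered-last (trans (lowered-other (a<b⇒a≢last first<last)) p-zero))
        (trans (cong (λ x → x ℤ.- + 1 ℤ.- + 0) p-last≡′) (identity (+ n) (+ m))))
      where
      identity : ∀ n m → n ℤ.* m ℤ.+ + 1 ℤ.- + 1 ℤ.- + 0 ≡ m ℤ.* n
      identity = solve-∀

    -- Lowering p last by one moves no other root across an integer: p last - p a ≢ K n + 1
    -- because that would give p a ≡ p first (mod n).
    wall-point-inside : ∀ a b → a Fin.< b → ¬ (a ≡ first × b ≡ last) →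
                        ι (K a b) ℚ.< pair wall-point a b × pair wall-point a b ℚ.< ι (K a b ℤ.+ + 1)
    wall-point-inside a b a<b not-θ with toSum (b Fin.≟ last)
    ... | inj₂ b≢last = ι<pair-point lowered a b {K a b} (subst (K a b ℤ.* + n ℤ.<_) (sym same) (K-floor-strict a b a<b)) ,
                      pair-point<ι lowered a b {K a b ℤ.+ + 1} (subst (ℤ._< _) (sym same) (proj₂ (K-floor a b a<b)))
      where
      same : lowered b ℤ.- lowered a ≡ p b ℤ.- p a
      same = cong₂ ℤ._-_ (lowered-other b≢last) (lowered-other (a<b⇒a≢last a<b))
    ... | inj₁ refl = ι<pair-point lowered a last {K a last} below , pair-point<ι lowered a last {K a last ℤ.+ + 1} above
      where
      D = p last ℤ.- p a
      lowered-D : lowered last ℤ.- lowered a ≡ D ℤ.- + 1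
      lowered-D = trans (cong₂ ℤ._-_ lowered-last (lowered-other (a<b⇒a≢last a<b))) (identity (p last) (p a))
        where
        identity : ∀ x y → x ℤ.- + 1 ℤ.- y ≡ x ℤ.- y ℤ.- + 1
        identity = solve-∀
      D≢K*n+1 : K a last ℤ.* + n ℤ.+ + 1 ≢ D
      D≢K*n+1 e = not-θ (≡-mod-n⇒≡ a first (+ m ℤ.- K a last) (begin
        p a                                                     ≡⟨ identity₁ (p last) (p a) ⟩
        p last ℤ.- D                                            ≡⟨ cong (λ d → p last ℤ.- d) (sym e) ⟩
        p last ℤ.- (K a last ℤ.* + n ℤ.+ + 1)                   ≡⟨ cong (λ x → x ℤ.- (K a last ℤ.* + n ℤ.+ + 1)) p-last≡′ ⟩
        + n ℤ.* + m ℤ.+ + 1 ℤ.- (K a last ℤ.* + n ℤ.+ + 1)     ≡⟨ identity₂ (+ n) (+ m) (K a last) ⟩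
        + 0 ℤ.+ (+ m ℤ.- K a last) ℤ.* + n                      ≡⟨ cong (λ x → x ℤ.+ (+ m ℤ.- K a last) ℤ.* + n) (sym p-zero) ⟩
        p first ℤ.+ (+ m ℤ.- K a last) ℤ.* + n                      ∎) , refl)
        where
        open ≡-Reasoning
        identity₁ : ∀ x y → y ≡ x ℤ.- (x ℤ.- y)
        identity₁ = solve-∀
        identity₂ : ∀ n m k → n ℤ.* m ℤ.+ + 1 ℤ.- (k ℤ.* n ℤ.+ + 1) ≡ + 0 ℤ.+ (m ℤ.- k) ℤ.* n
        identity₂ = solve-∀
      below : K a last ℤ.* + n ℤ.< lowered last ℤ.- lowered a
      below = subst₂ ℤ._<_ (identity (K a last ℤ.* + n)) (sym lowered-D)
        (ℤP.+-monoˡ-< (ℤ.- + 1) (ℤP.≤∧≢⇒< (i<j⇒i+1≤j (K-floor-strict a last a<b)) D≢K*n+1))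
        where
        identity : ∀ x → x ℤ.+ + 1 ℤ.+ ℤ.- + 1 ≡ x
        identity = solve-∀
      above : lowered last ℤ.- lowered a ℤ.< (K a last ℤ.+ + 1) ℤ.* + n
      above = subst (ℤ._< (K a last ℤ.+ + 1) ℤ.* + n) (sym lowered-D)
        (ℤP.≤-<-trans (ℤP.i-j≤i D (+ 1)) (proj₂ (K-floor a last a<b)))

    private
      wall-point-off-θ : ∀ {a b} k → a Fin.< b → ¬ (a ≡ first × b ≡ last) → ¬ OnH wall-point a b k
      wall-point-off-θ {a} {b} k a<b not-θ =
        ι-strictly-between⇒≢ {K a b} k (proj₁ (wall-point-inside a b a<b not-θ)) (proj₂ (wall-point-inside a b a<b not-θ))

      wall-point-closed : ∀ a b → a Fin.< b → ι (K a b) ℚ.≤ pair wall-point a b × pair wall-point a b ℚ.≤ ι (K a b ℤ.+ + 1)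
      wall-point-closed a b a<b with toSum (a Fin.≟ first) | toSum (b Fin.≟ last)
      ... | inj₁ refl | inj₁ refl =
        ℚP.≤-reflexive (trans (cong ι K-θ≡m) (sym wall-point-on-θ)) ,
        ℚP.≤-trans (ℚP.≤-reflexive (trans wall-point-on-θ (cong ι (sym K-θ≡m)))) (ι-mono-≤ (ℤP.i≤i+j (K first last) (+ 1)))
      ... | inj₁ _    | inj₂ b≢last = map ℚP.<⇒≤ ℚP.<⇒≤ (wall-point-inside a b a<b λ { (_ , b≡) → b≢last b≡ })
      ... | inj₂ a≢first  | _           = map ℚP.<⇒≤ ℚP.<⇒≤ (wall-point-inside a b a<b λ { (a≡ , _) → a≢first a≡ })

    segment-in-alcove : ∀ t → 0ℚ ℚ.< t → t ℚ.≤ 1ℚ → InAlcove K (segment wall-point (point p) t)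
    segment-in-alcove t 0<t t≤1 =
      trans (sum-segment wall-point (point p) t)
        (trans (cong₂ (λ u v → lerp u v t) (point-InV lowered) (point-InV p)) (lerp-same 0ℚ t)) ,
      λ a b a<b →
        subst (ι (K a b) ℚ.<_) (sym (pair-segment wall-point (point p) t a b))
          (lerp-lower (proj₁ (wall-point-closed a b a<b)) (proj₁ (proj₂ point-p-in-alcove a b a<b)) 0<t t≤1) ,
        subst (ℚ._< ι (K a b ℤ.+ + 1)) (sym (pair-segment wall-point (point p) t a b))
          (lerp-upper (proj₂ (wall-point-closed a b a<b)) (proj₂ (proj₂ point-p-in-alcove a b a<b)) 0<t t≤1)

    wall-point-only-θ : ∀ a b k → a Fin.< b → ShiLevel m k → ¬ (a ≡ first × b ≡ last × k ≡ + m) → ¬ OnH wall-point a b k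
    wall-point-only-θ a b k a<b _ not-θ on with toSum (a Fin.≟ first) | toSum (b Fin.≟ last)
    ... | inj₁ refl | inj₁ refl   = not-θ (refl , refl , ι-injective (trans (sym on) wall-point-on-θ))
    ... | inj₁ _    | inj₂ b≢last = wall-point-off-θ k a<b (λ { (_ , b≡) → b≢last b≡ }) on
    ... | inj₂ a≢first  | _           = wall-point-off-θ k a<b (λ { (a≡ , _) → a≢first a≡ }) on

    θ-wall : ThetaWall m x0
    θ-wall = first , last , (refl , toℕ-last) ,
      (first<last , m∈ShiLevel , wall-point , point-InV lowered , wall-point-on-θ ,
        (point p , point-p-in-region ,
          λ t 0<t t≤1 → K-in-region (segment wall-point (point p) t) (segment-in-alcove t 0<t t≤1)) ,
        wall-point-only-θ) ,
      inj₁ (region-above-m K-θ≡m , λ y y∈ → ℚP.<⇒≤ (A0-below-m y y∈))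

  module PositionFromWall {x y : Pt n} (x-on-θ : OnH x first last (+ m))
           (segment-in-region : ∀ t → 0ℚ ℚ.< t → t ℚ.≤ 1ℚ → InRegion m x0 (segment x y t))
           (x-only-θ : ∀ a b k → a Fin.< b → ShiLevel m k → ¬ (a ≡ first × b ≡ last × k ≡ + m) → ¬ OnH x a b k)
           (region-above : ∀ y → InRegion m x0 y → ι (+ m) ℚ.≤ pair y first last) where

    K-θ≥m : + m ℤ.≤ K first last
    K-θ≥m = i<j+1⇒i≤j (ι-cancel-< {+ m} {K first last ℤ.+ + 1}
      (ℚP.≤-<-trans (region-above (point p) point-p-in-region) (proj₂ (proj₂ point-p-in-alcove first last first<last))))

    private
      wall-above : ∀ a b k → a Fin.< b → ShiLevel m k → k ℤ.≤ K a b → ¬ (a ≡ first × b ≡ last) → ι k ℚ.< pair x a b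
      wall-above a b k a<b k∈ k≤K not-θ = ≤∧≢⇒<
        (closure-above {x} {y} {point p} segment-in-region point-p-in-region a<b k∈
          (ℚP.<⇒≤ (ℚP.≤-<-trans (ι-mono-≤ k≤K) (proj₁ (proj₂ point-p-in-alcove a b a<b)))))
        (λ k≡ → x-only-θ a b k a<b k∈ (λ { (a≡ , b≡ , _) → not-θ (a≡ , b≡) }) (sym k≡))

    -- m = ⟨x , e_first - e_c⟩ + ⟨x , e_c - e_last⟩, and x lies strictly above every other wall of R.
    subroot-bound : SubrootBound
    subroot-bound c first<c c<last = i<j⇒i+1≤j (ι-cancel-< {K first c ℤ.+ K c last} {+ m}
      (subst (ι (K first c ℤ.+ K c last) ℚ.<_) u+v≡m
        (subst (ℚ._< u ℚ.+ v) (sym (ι-homo-+ (K first c) (K c last)))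
          (ℚP.+-mono-< (wall-above first c (K first c) first<c (K-level first<c K-first-c≤m) ℤP.≤-refl not-θ₁)
                       (wall-above c last (K c last) c<last (K-level c<last K-c-last≤m) ℤP.≤-refl not-θ₂)))))
      where
      open import Data.Rational.Solver using (module +-*-Solver)
      open +-*-Solver using (solve; _:+_; _:-_; _:=_)
      u = pair x first c
      v = pair x c last
      telescope : ∀ xa xb xc → (xa ℚ.- xb) ℚ.+ (xb ℚ.- xc) ≡ xa ℚ.- xc
      telescope = solve 3 (λ xa xb xc → (xa :- xb) :+ (xb :- xc) := xa :- xc) refl
      u+v≡m : u ℚ.+ v ≡ ι (+ m)
      u+v≡m = trans (telescope (x first) (x c) (x last)) x-on-θ
      not-θ₁ : ¬ (first ≡ first × c ≡ last)
      not-θ₁ (_ , c≡last) = FinP.<-irrefl c≡last c<last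
      not-θ₂ : ¬ (c ≡ first × last ≡ last)
      not-θ₂ (c≡first , _) = FinP.<-irrefl (sym c≡first) first<c
      K-level : ∀ {a b} → a Fin.< b → K a b ℤ.≤ + m → ShiLevel m (K a b)
      K-level {a} {b} a<b K≤m = ℤP.<-≤-trans ℤ.-<+ (K-nonNeg a b a<b) , K≤m
      0<u : 0ℚ ℚ.< u
      0<u = wall-above first c (+ 0) first<c 0∈ShiLevel (K-nonNeg first c first<c) not-θ₁
      0<v : 0ℚ ℚ.< v
      0<v = wall-above c last (+ 0) c<last 0∈ShiLevel (K-nonNeg c last c<last) not-θ₂
      K-first-c≤m : K first c ℤ.≤ + m
      K-first-c≤m = ℤP.≮⇒≥ λ m<K → ℚP.<-irrefl (sym u+v≡m) (subst (ℚ._< u ℚ.+ v) (ℚP.+-identityʳ (ι (+ m)))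
        (ℚP.+-mono-< (wall-above first c (+ m) first<c m∈ShiLevel (ℤP.<⇒≤ m<K) not-θ₁) 0<v))
      K-c-last≤m : K c last ℤ.≤ + m
      K-c-last≤m = ℤP.≮⇒≥ λ m<K → ℚP.<-irrefl (sym u+v≡m) (subst (ℚ._< u ℚ.+ v) (ℚP.+-identityˡ (ι (+ m)))
        (ℚP.+-mono-< 0<u (wall-above c last (+ m) c<last m∈ShiLevel (ℤP.<⇒≤ m<K) not-θ₂)))

  private
    one : Fin n
    one = Fin.suc Fin.zero

    1<n : 1 ℕ.< n
    1<n = ℕ.s≤s (ℕ.s≤s ℕ.z≤n)

  -- The position with residue 1 lies strictly inside θ and splits it into two roots whose
  -- coordinates add up to at least m whenever p last has residue at least 2.
  residue-one : ∀ r → r ℕ.< n → p last ≡ + m ℤ.* + n ℤ.+ + r → SubrootBound → r ≡ 1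
  residue-one zero _ p-last≡ _ =
    ⊥-elim (FinP.<-irrefl (sym (≡-mod-n⇒≡ last first (+ m) (trans p-last≡ (identity (+ m ℤ.* + n) (p first) p-zero)))) first<last)
    where
    identity : ∀ x y → y ≡ + 0 → x ℤ.+ + 0 ≡ y ℤ.+ x
    identity x y refl = trans (ℤP.+-identityʳ x) (sym (ℤP.+-identityˡ x))
  residue-one (suc zero) _ _ _ = refl
  residue-one (suc (suc t)) r<n p-last≡ bound = ⊥-elim (ℤP.<⇒≱ m<sum (bound j first<j j<last))
    where
    j  = proj₁ (level⇒p one)
    q₁ = proj₁ (level-nonNeg one)
    pj≡ : p j ≡ + q₁ ℤ.* + n ℤ.+ + 1
    pj≡ = trans (proj₂ (level⇒p one)) (cong (λ l → l ℤ.* + n ℤ.+ + 1) (proj₂ (level-nonNeg one)))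
    first<j : first Fin.< j
    first<j = FinP.≤∧≢⇒< ℕ.z≤n λ first≡j → ℕP.0≢1+n (proj₂ (quotRem-injective n {+ 0} {+ q₁} {0} {1} (ℕ.s≤s ℕ.z≤n) 1<n
            (trans (sym p-zero) (trans (cong p first≡j) pj≡))))
    j<last : j Fin.< last
    j<last = FinP.≤∧≢⇒< (FinP.≤fromℕ j) λ j≡last → case-absurd (proj₂ (quotRem-injective n {+ q₁} {+ m} 1<n r<n
               (trans (sym pj≡) (trans (cong p j≡last) p-last≡))))
      where
      case-absurd : 1 ≢ suc (suc t)
      case-absurd ()
    K-first-j≥q₁ : + q₁ ℤ.≤ K first j
    K-first-j≥q₁ = floor-mono n {+ q₁} {K first j} {p j ℤ.- p first}
      (subst (+ q₁ ℤ.* + n ℤ.≤_) (sym (trans (cong (λ x → p j ℤ.- x) p-zero) (trans (ℤP.+-identityʳ (p j)) pj≡)))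
        (ℤP.i≤i+j (+ q₁ ℤ.* + n) (+ 1)))
      (proj₂ (K-floor first j first<j))
    K-j-last≥m-q₁ : + m ℤ.- + q₁ ℤ.≤ K j last
    K-j-last≥m-q₁ = floor-mono n {+ m ℤ.- + q₁} {K j last} {p last ℤ.- p j}
      (subst ((+ m ℤ.- + q₁) ℤ.* + n ℤ.≤_) (sym (trans (cong₂ ℤ._-_ p-last≡ pj≡) (identity (+ m) (+ n) (+ q₁) (+ suc t))))
        (ℤP.i≤i+j ((+ m ℤ.- + q₁) ℤ.* + n) (+ suc t)))
      (proj₂ (K-floor j last j<last))
      where
      identity : ∀ m n q s → m ℤ.* n ℤ.+ (+ 1 ℤ.+ s) ℤ.- (q ℤ.* n ℤ.+ + 1) ≡ (m ℤ.- q) ℤ.* n ℤ.+ s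
      identity = solve-∀
    m<sum : + m ℤ.< K first j ℤ.+ K j last ℤ.+ + 1
    m<sum = i≤j⇒i<j+1 (subst (ℤ._≤ K first j ℤ.+ K j last) (identity (+ m) (+ q₁))
      (ℤP.+-mono-≤ K-first-j≥q₁ K-j-last≥m-q₁))
      where
      identity : ∀ m q → q ℤ.+ (m ℤ.- q) ≡ m
      identity = solve-∀

  p-last-from-subroot : K first last ≡ + m → SubrootBound → p last ≡ + (n ℕ.* m ℕ.+ 1)
  p-last-from-subroot K-θ≡m bound with p-as-level last
  ... | i , q , _ , p≡ =
    trans p≡ (cong +_ (trans (cong₂ (λ q r → q ℕ.* n ℕ.+ r) q≡m r≡1) (cong (ℕ._+ 1) (ℕP.*-comm m n))))
    where
    D≡ : p last ℤ.- p first ≡ + (q ℕ.* n ℕ.+ toℕ i)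
    D≡ = trans (cong₂ ℤ._-_ p≡ p-zero) (ℤP.+-identityʳ _)
    floor-q = quotRem-floor n {q} {toℕ i} (FinP.toℕ<n i)
    q≡m : q ≡ m
    q≡m = ℤP.+-injective (floor-unique n (proj₁ floor-q) (proj₂ floor-q)
            (subst₂ (λ k d → k ℤ.* + n ℤ.≤ d) K-θ≡m D≡ (proj₁ (K-floor first last first<last)))
            (subst₂ (λ k d → d ℤ.< (k ℤ.+ + 1) ℤ.* + n) K-θ≡m D≡ (proj₂ (K-floor first last first<last))))
    r≡1 : toℕ i ≡ 1
    r≡1 = residue-one (toℕ i) (FinP.toℕ<n i)
      (trans p≡ (trans (cong (λ q′ → + (q′ ℕ.* n ℕ.+ toℕ i)) q≡m) (sym (pos-*-+ m (toℕ i))))) bound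

  θ-unique : ∀ {a b} → IsTheta a b → a ≡ first × b ≡ last
  θ-unique (a≡0 , 1+b≡n) =
    FinP.toℕ-injective a≡0 , FinP.toℕ-injective (trans (ℕP.suc-injective 1+b≡n) (sym (FinP.toℕ-fromℕ (suc n-2))))

  θ-wall⇔p-last : (+ m ℤ.≤ K first last → SubrootBound → K first last ℤ.≤ + m) →
                  ThetaWall m x0 ⇔ (p last ≡ + (n ℕ.* m ℕ.+ 1))
  θ-wall⇔p-last K-θ≤m = mk⇔ wall⇒p-last WallFromPosition.θ-wall
    where
    separating⇒p-last : IsSeparatingWall m x0 first last (+ m) → p last ≡ + (n ℕ.* m ℕ.+ 1)
    separating⇒p-last (_ , inj₂ (_ , A0-above)) = ⊥-elim (A0-not-above-m A0-above)
    separating⇒p-last ((_ , _ , x , _ , x-on , (y , _ , seg) , x-only) , inj₁ (region-above , _)) =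
      p-last-from-subroot (ℤP.≤-antisym (K-θ≤m W.K-θ≥m W.subroot-bound) W.K-θ≥m) W.subroot-bound
      where module W = PositionFromWall {x} {y} x-on seg x-only region-above
    wall⇒p-last : ThetaWall m x0 → p last ≡ + (n ℕ.* m ℕ.+ 1)
    wall⇒p-last (a , b , θ , wall) with θ-unique θ
    ... | refl , refl = separating⇒p-last wall

  θ-wall⇔Hook11 : (+ m ℤ.≤ K first last → SubrootBound → K first last ℤ.≤ + m) →
                  ThetaWall m x0 ⇔ Hook11Is λ′ (n ℕ.* m-1 ℕ.+ 1)
  θ-wall⇔Hook11 K-θ≤m = equivalence (θ-wall⇔p-last K-θ≤m) (⇔-sym (Hook11⇔p-last m-1))

open import Data.Nat using (_≤_; _*_; _+_; _∸_; s≤s; z≤n)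

theorem3p1 : (n m : ℕ) → 2 ≤ n → 1 ≤ m →
    (x0 : Pt n) → InV x0 → InComplement m x0 → DominantRegion m x0 →
    (K : Shi n) → IsMinimalAlcove m x0 K →
    (λ′ : List ℕ) → IsPartition λ′ → IsCore n λ′ → PsiIs n λ′ K →
    ((Σ (Fin n) λ a → Σ (Fin n) λ b → IsTheta a b × IsSeparatingWall m x0 a b (+ m))
      ⇔ Hook11Is λ′ (n * (m ∸ 1) + 1))
-- Only the region of x0 matters.
theorem3p1 zero _ () _ _ _ _ _ _ _ _ _ _ _
theorem3p1 (suc zero) _ (s≤s ()) _ _ _ _ _ _ _ _ _ _ _
theorem3p1 (suc (suc _)) zero _ () _ _ _ _ _ _ _ _ _ _
theorem3p1 (suc (suc zero)) (suc m-1) _ _ x0 _ _ _ K minimal λ′ P core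
           (level , p , level-spec , p-increasing , level⇒p , p⇒level , K-floor) =
  Walls.θ-wall⇔Hook11 0 m-1 {x0} {K} (proj₁ (proj₂ minimal)) P core
    level p level-spec p-increasing level⇒p p⇒level K-floor
    (λ m≤K _ → rank-two-θ≤m m-1 {x0} {K} minimal m≤K)
theorem3p1 (suc (suc (suc n-3))) (suc m-1) _ _ x0 _ _ _ K minimal λ′ P core
           (level , p , level-spec , p-increasing , level⇒p , p⇒level , K-floor) =
  W.θ-wall⇔Hook11 (λ _ → W.K-θ≤m-via (Fin.suc Fin.zero) (s≤s z≤n) (s≤s (s≤s z≤n)))
  where
  module W = Walls (suc n-3) m-1 {x0} {K} (proj₁ (proj₂ minimal)) P core
                   level p level-spec p-increasing level⇒p p⇒level K-floor
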